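{- Let $p\geq5$ be a prime, $k$ even, $q=p^k$, $G_q=\mathrm{PSL}(2,q)$, and $\Delta\in\mathbb{F}_q$ a non-square. Let $R_\Delta$ be the image of $\begin{pmatrix}1&\Delta\\0&1\end{pmatrix}$ in $G_q$, let $\mathcal{D}_\Delta$ be the conjugacy class of $R_\Delta$ in $G_q$, and let $\Gamma_q^-$ be the graph with vertex set $\mathcal{D}_\Delta$ in which distinct $g,h$ are adjacent iff $hg^{ -1}\in\mathcal{D}_\Delta$. Let \[\mathscr{C}_1=\left\{\text{image of }\begin{pmatrix}1&a^2\Delta\\0&1\end{pmatrix} : a\in\mathbb{F}_q\setminus\{0,1,-1\},\ a^2-1\in(\mathbb{F}_q)^2\right\},\] \[\mathscr{C}_2=\left\{\text{image of }\begin{pmatrix}1+4b\Delta^{ -1}&-4b^2\Delta^{ -1}\\4\Delta^{ -1}&1-4b\Delta^{ -1}\end{pmatrix} : b\in\mathbb{F}_q\right\}.\] Then the neighbourhood of $R_\Delta$ in $\Gamma_q^-$ is $\mathscr{C}_1\cup\mathscr{C}_2$, and it has size $\frac{q-5}{4}+q$.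
   Context: $(\mathbb{F}_q)^2$ denotes the set of squares in $\mathbb{F}_q$ (including $0$). Since $k$ is even, every element of $\mathbb{F}_p$ is a square in $\mathbb{F}_q$, so $\mathcal{D}_\Delta$ contains all non-identity elements of $\langle R_\Delta\rangle$, and $\Gamma_q^-$ is the subgraph, induced on the neighbours of the identity, of the complement of the derangement graph of $G_q$ acting on cosets of $\langle R_\Delta\rangle$. -}

module Defs where

open import Level using (0ℓ)
open import Algebra.Bundles using (CommutativeRing)
open import Data.Nat using (ℕ)
open import Data.List using (List; length)
open import Data.List.Relation.Unary.Any using (Any)
open import Data.List.Relation.Unary.All using (All)
open import Data.List.Relation.Unary.AllPairs using (AllPairs)
open import Data.Product using (Σ; ∃; _×_)
open import Data.Sum using (_⊎_)
open import Relation.Nullary using (¬_)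
open import Relation.Binary.PropositionalEquality using (_≡_)
open import Relation.Binary.Definitions using (Decidable)

module Mat (R : CommutativeRing 0ℓ 0ℓ) where
  open CommutativeRing R

  IsField : Set
  IsField = (¬ 0# ≈ 1#) × (∀ x → ¬ x ≈ 0# → ∃ λ y → x * y ≈ 1#)

  HasCard : ℕ → Set
  HasCard n = Σ (List Carrier) λ xs →
    (length xs ≡ n) × (∀ x → Any (x ≈_) xs) × AllPairs (λ x y → ¬ x ≈ y) xs

  IsSquare : Carrier → Set
  IsSquare x = ∃ λ y → y * y ≈ x

  4# : Carrier
  4# = 1# + 1# + 1# + 1#

  record M2 : Set where
    constructor mat
    field a b c d : Carrier
  open M2 public

  _≈M_ : M2 → M2 → Set
  X ≈M Y = (a X ≈ a Y) × (b X ≈ b Y) × (c X ≈ c Y) × (d X ≈ d Y)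

  _·_ : M2 → M2 → M2
  X · Y = mat (a X * a Y + b X * c Y) (a X * b Y + b X * d Y)
              (c X * a Y + d X * c Y) (c X * b Y + d X * d Y)

  negM : M2 → M2
  negM X = mat (- a X) (- b X) (- c X) (- d X)

  det : M2 → Carrier
  det X = a X * d X - b X * c X

  InSL : M2 → Set
  InSL X = det X ≈ 1#

  -- inverse of a determinant-one matrix (adjugate)
  invM : M2 → M2
  invM X = mat (d X) (- b X) (- c X) (a X)

  -- equality of images in PSL(2,R) = SL(2,R)/{±I}
  _∼_ : M2 → M2 → Set
  X ∼ Y = (X ≈M Y) ⊎ (X ≈M negM Y)

  RΔ : Carrier → M2
  RΔ Δ = mat 1# Δ 0# 1#

  InD : Carrier → M2 → Set
  InD Δ X = InSL X × ∃ λ H → InSL H × (X ∼ ((H · RΔ Δ) · invM H))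

  Nbr : Carrier → M2 → Set
  Nbr Δ X = InD Δ X × (¬ X ∼ RΔ Δ) × InD Δ (X · invM (RΔ Δ))

  C1 : Carrier → M2 → Set
  C1 Δ X = ∃ λ α → (¬ α ≈ 0#) × (¬ α ≈ 1#) × (¬ α ≈ - 1#)
           × IsSquare (α * α - 1#) × (X ∼ mat 1# (α * α * Δ) 0# 1#)

  -- 𝒞₂ ; Δi is Δ⁻¹
  C2 : Carrier → Carrier → M2 → Set
  C2 Δ Δi X = ∃ λ β →
    X ∼ mat (1# + 4# * β * Δi) (- (4# * β * β * Δi)) (4# * Δi) (1# - 4# * β * Δi)

module Submission where

-- Conjugating R_Δ by H ∈ SL₂ with first column (u, v) gives U(u, v) = I + Δ (u, v)ᵀ (-v, u), so a
-- neighbour X of R_Δ satisfies X ∼ U(u, v) and U(u, v) R_Δ⁻¹ = ±U(u′, v′). Comparing traces, the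
-- sign + forces v = 0, whence X ∼ [[1, u²Δ], [0, 1]] with u² - 1 = u′² a nonzero square (𝒞₁);
-- the sign - forces Δ²v² = -4, and X is the matrix of 𝒞₂ with b = -Δ²uv/4. Conversely q ≡ 1
-- (mod 4) provides i with i² = -1, and v = 2iΔ⁻¹ realises every matrix of 𝒞₂ as a conjugate.
-- 𝒞₂ contributes one class per b, so q of them; 𝒞₁ one class per s = u² with s and s - 1 nonzero
-- squares, and t ↦ ((t + t⁻¹)/2)² maps the q - 5 elements t ∉ {0, ±1, ±i} 4-to-1 onto these s.

open import Defs
open import Level using (Level; 0ℓ)
open import Algebra.Bundles using (CommutativeRing)
open import Data.Nat.Base as ℕ using (ℕ)
open import Data.List.Base using (List; length)
open import Data.List.Relation.Unary.Any using (Any)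
open import Data.List.Relation.Unary.AllPairs using (AllPairs)
open import Relation.Nullary using (¬_)
open import Relation.Binary.Core using (Rel)
open import Relation.Binary.Structures using (IsEquivalence)
import Relation.Binary.Definitions as B
open import Relation.Binary.PropositionalEquality using (_≡_)


module ModFour where
  open import Data.Nat.Base using (zero; suc; _+_; _*_; _^_; _∸_; _/_; _%_; _<_; s≤s)
  open import Data.Nat.Properties
  open import Data.Nat.DivMod using (m≡m%n+[m/n]*n; m%n<n; m*n/n≡m)
  open import Data.Nat.Divisibility using (_∣_; divides)
  open import Data.Nat.Primality using (Prime; prime⇒irreducible)
  open import Data.Nat.Tactic.RingSolver using (solve-∀)
  open import Data.Product using (∃; _,_)
  open import Data.Sum using (inj₁; inj₂)
  open import Relation.Nullary.Negation using (contradiction)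
  open import Relation.Binary.PropositionalEquality using (_≡_; _≢_; refl; sym; trans; cong; cong₂)

  prime>2⇒odd : ∀ {p} → Prime p → 2 < p → ∃ λ a → p ≡ suc (2 * a)
  prime>2⇒odd {p} pr 2<p with p % 2 | m%n<n p 2 | m≡m%n+[m/n]*n p 2
  ... | 0 | _ | p≡[p/2]*2 with prime⇒irreducible pr (divides (p / 2) p≡[p/2]*2)
  ...   | inj₁ ()
  ...   | inj₂ 2≡p = contradiction 2≡p (<⇒≢ 2<p)
  prime>2⇒odd {p} pr 2<p | 1 | _ | p≡1+[p/2]*2 = p / 2 , trans p≡1+[p/2]*2 (cong suc (*-comm (p / 2) 2))
  prime>2⇒odd {p} pr 2<p | suc (suc _) | s≤s (s≤s ()) | _

  odd^n-odd : ∀ {p a} n → p ≡ suc (2 * a) → ∃ λ b → p ^ n ≡ suc (2 * b)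
  odd^n-odd zero _ = 0 , refl
  odd^n-odd {p} {a} (suc n) p≡1+2a with odd^n-odd {a = a} n p≡1+2a
  ... | b , p^n≡1+2b = a + b + 2 * a * b , trans (cong₂ _*_ p≡1+2a p^n≡1+2b) (identity a b)
    where
    identity : ∀ a b → suc (2 * a) * suc (2 * b) ≡ suc (2 * (a + b + 2 * a * b))
    identity = solve-∀

  even-power-of-odd-prime : ∀ {p k} → Prime p → 2 < p → 2 ∣ k → ∃ λ c → p ^ k ≡ 4 * c + 1
  even-power-of-odd-prime {p} pr 2<p (divides j refl) with prime>2⇒odd pr 2<p
  ... | a , p≡1+2a with odd^n-odd {a = a} j p≡1+2a
  ... | b , p^j≡1+2b = b + b * b , trans (sym (^-*-assoc p j 2)) (trans (cong (_^ 2) p^j≡1+2b) (identity b))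
    where
    identity : ∀ b → suc (2 * b) * (suc (2 * b) * 1) ≡ 4 * (b + b * b) + 1
    identity = solve-∀

  4c+1≢2x : ∀ c x → 4 * c + 1 ≢ 2 * x
  4c+1≢2x c x eq = even≢odd x (2 * c) (sym (trans (regroup c) eq))
    where
    regroup : ∀ c → suc (2 * (2 * c)) ≡ 4 * c + 1
    regroup = solve-∀

  4c+1≢4m+3 : ∀ c m → 4 * c + 1 ≢ 4 * m + 3
  4c+1≢4m+3 c m eq =
    even≢odd c m (*-cancelˡ-≡ (2 * c) (suc (2 * m)) 2 (suc-injective (trans (sym (regroupˡ c)) (trans eq (regroupʳ m)))))
    where
    regroupˡ : ∀ c → 4 * c + 1 ≡ suc (2 * (2 * c))
    regroupˡ = solve-∀
    regroupʳ : ∀ m → 4 * m + 3 ≡ suc (2 * suc (2 * m))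
    regroupʳ = solve-∀

  q≡4m+5⇒[q∸5]/4≡m : ∀ q m → q ≡ 4 * m + 5 → (q ∸ 5) / 4 ≡ m
  q≡4m+5⇒[q∸5]/4≡m q m refl = trans (cong (_/ 4) (trans (m+n∸n≡m (4 * m) 5) (*-comm 4 m))) (m*n/n≡m m 4)


-- The standard library's ring solver instantiated with integer coefficients through the
-- canonical map ℤ → R: coefficients then normalise by computation in ℤ, so identities whose
-- proof needs cancellation (such as x - x ≈ 0) are decided. The optimised ℕ-multiple _×_
-- makes the constant con (+ 4) evaluate to Defs' 4# = 1# + 1# + 1# + 1# on the nose.
module IntegerSolver {c ℓ : Level} (R : CommutativeRing c ℓ) where
  open import Algebra.Solver.Ring.AlmostCommutativeRing
    using (_-Raw-AlmostCommutative⟶_; fromCommutativeRing; Induced-equivalence)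
  open import Data.Nat.Base using (zero; suc)
  import Data.Nat.Properties as ℕ
  open import Data.Integer.Base as ℤ using (ℤ; +_; -[1+_])
  import Data.Integer.Properties as ℤ
  open import Data.Maybe.Base using (just; nothing)
  open import Data.Sign.Base as Sign using (Sign)
  open import Relation.Binary.Definitions using (WeaklyDecidable)
  open import Relation.Nullary using (yes; no)
  import Relation.Binary.PropositionalEquality.Core as ≡

  open CommutativeRing R
  open import Algebra.Properties.Ring ring using (-‿distribˡ-*; -‿distribʳ-*; -‿involutive; -0#≈0#)
  open import Algebra.Properties.AbelianGroup +-abelianGroup using (⁻¹-∙-comm)
  open import Algebra.Properties.Semiring.Mult.TCOptimised semiring using (_×_; 1+×; ×-homo-+; ×1-homo-*)
  open import Relation.Binary.Reasoning.Setoid setoid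
  open import Algebra.Properties.Group +-group using (x∙y⁻¹≈ε⇒x≈y; x≈y⇒x∙y⁻¹≈ε)

  private
    fromℕ : ℕ → Carrier
    fromℕ k = k × 1#

  ⟦_⟧ᶻ : ℤ → Carrier
  ⟦ + n ⟧ᶻ = fromℕ n
  ⟦ -[1+ n ] ⟧ᶻ = - fromℕ (suc n)

  private
    signed : Sign → Carrier → Carrier
    signed Sign.+ x = x
    signed Sign.- x = - x

    signed-cong : ∀ s {x y} → x ≈ y → signed s x ≈ signed s y
    signed-cong Sign.+ e = e
    signed-cong Sign.- e = -‿cong e

    signed-* : ∀ s t x y → signed (s Sign.* t) (x * y) ≈ signed s x * signed t y
    signed-* Sign.+ Sign.+ x y = refl
    signed-* Sign.+ Sign.- x y = -‿distribʳ-* x y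
    signed-* Sign.- Sign.+ x y = -‿distribˡ-* x y
    signed-* Sign.- Sign.- x y = begin
      x * y         ≈⟨ -‿involutive (x * y) ⟨
      - - (x * y)   ≈⟨ -‿cong (-‿distribʳ-* x y) ⟩
      - (x * - y)   ≈⟨ -‿distribˡ-* x (- y) ⟩
      - x * - y     ∎

    ◃-homo : ∀ s k → ⟦ s ℤ.◃ k ⟧ᶻ ≈ signed s (fromℕ k)
    ◃-homo Sign.+ zero = refl
    ◃-homo Sign.- zero = sym -0#≈0#
    ◃-homo Sign.+ (suc k) = refl
    ◃-homo Sign.- (suc k) = refl

    sign-abs : ∀ i → ⟦ i ⟧ᶻ ≈ signed (ℤ.sign i) (fromℕ ℤ.∣ i ∣)
    sign-abs (+ k) = refl
    sign-abs -[1+ k ] = refl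

    1+x-[1+y]≈x-y : ∀ x y → (1# + x) - (1# + y) ≈ x - y
    1+x-[1+y]≈x-y x y = begin
      (1# + x) + - (1# + y)     ≈⟨ +-congˡ (⁻¹-∙-comm 1# y) ⟨
      (1# + x) + (- 1# + - y)   ≈⟨ +-congʳ (+-comm 1# x) ⟩
      (x + 1#) + (- 1# + - y)   ≈⟨ +-assoc x 1# (- 1# + - y) ⟩
      x + (1# + (- 1# + - y))   ≈⟨ +-congˡ (+-assoc 1# (- 1#) (- y)) ⟨
      x + ((1# + - 1#) + - y)   ≈⟨ +-congˡ (+-congʳ (-‿inverseʳ 1#)) ⟩
      x + (0# + - y)            ≈⟨ +-congˡ (+-identityˡ (- y)) ⟩
      x - y                     ∎

    ⊖-homo : ∀ i j → ⟦ i ℤ.⊖ j ⟧ᶻ ≈ fromℕ i - fromℕ j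
    ⊖-homo zero zero = sym (trans (+-congˡ -0#≈0#) (+-identityʳ 0#))
    ⊖-homo (suc i) zero = sym (trans (+-congˡ -0#≈0#) (+-identityʳ _))
    ⊖-homo zero (suc j) = sym (+-identityˡ _)
    ⊖-homo (suc i) (suc j) = begin
      ⟦ suc i ℤ.⊖ suc j ⟧ᶻ              ≡⟨ ≡.cong ⟦_⟧ᶻ (ℤ.[1+m]⊖[1+n]≡m⊖n i j) ⟩
      ⟦ i ℤ.⊖ j ⟧ᶻ                      ≈⟨ ⊖-homo i j ⟩
      fromℕ i - fromℕ j                 ≈⟨ 1+x-[1+y]≈x-y (fromℕ i) (fromℕ j) ⟨
      (1# + fromℕ i) - (1# + fromℕ j)   ≈⟨ +-cong (1+× i 1#) (-‿cong (1+× j 1#)) ⟨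
      fromℕ (suc i) - fromℕ (suc j)     ∎

    +-homo : ∀ i j → ⟦ i ℤ.+ j ⟧ᶻ ≈ ⟦ i ⟧ᶻ + ⟦ j ⟧ᶻ
    +-homo (+ i) (+ j) = ×-homo-+ 1# i j
    +-homo (+ i) -[1+ j ] = ⊖-homo i (suc j)
    +-homo -[1+ i ] (+ j) = trans (⊖-homo j (suc i)) (+-comm _ _)
    +-homo -[1+ i ] -[1+ j ] = begin
      - fromℕ (suc (suc (i ℕ.+ j)))        ≡⟨ ≡.cong (λ k → - fromℕ (suc k)) (≡.sym (ℕ.+-suc i j)) ⟩
      - fromℕ (suc i ℕ.+ suc j)            ≈⟨ -‿cong (×-homo-+ 1# (suc i) (suc j)) ⟩
      - (fromℕ (suc i) + fromℕ (suc j))    ≈⟨ ⁻¹-∙-comm _ _ ⟨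
      - fromℕ (suc i) + - fromℕ (suc j)    ∎

    *-homo : ∀ i j → ⟦ i ℤ.* j ⟧ᶻ ≈ ⟦ i ⟧ᶻ * ⟦ j ⟧ᶻ
    *-homo i j = begin
      ⟦ (s Sign.* t) ℤ.◃ (∣i∣ ℕ.* ∣j∣) ⟧ᶻ            ≈⟨ ◃-homo (s Sign.* t) (∣i∣ ℕ.* ∣j∣) ⟩
      signed (s Sign.* t) (fromℕ (∣i∣ ℕ.* ∣j∣))      ≈⟨ signed-cong (s Sign.* t) (×1-homo-* ∣i∣ ∣j∣) ⟩
      signed (s Sign.* t) (fromℕ ∣i∣ * fromℕ ∣j∣)    ≈⟨ signed-* s t _ _ ⟩
      signed s (fromℕ ∣i∣) * signed t (fromℕ ∣j∣)    ≈⟨ *-cong (sign-abs i) (sign-abs j) ⟨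
      ⟦ i ⟧ᶻ * ⟦ j ⟧ᶻ                                ∎
      where
      s = ℤ.sign i
      t = ℤ.sign j
      ∣i∣ = ℤ.∣ i ∣
      ∣j∣ = ℤ.∣ j ∣

    -‿homo : ∀ i → ⟦ ℤ.- i ⟧ᶻ ≈ - ⟦ i ⟧ᶻ
    -‿homo (+ zero) = sym -0#≈0#
    -‿homo (+ suc k) = refl
    -‿homo -[1+ k ] = sym (-‿involutive _)

  ℤ⟶R : ℤ.+-*-rawRing -Raw-AlmostCommutative⟶ fromCommutativeRing R
  ℤ⟶R = record
    { ⟦_⟧ = ⟦_⟧ᶻ
    ; +-homo = +-homo
    ; *-homo = *-homo
    ; -‿homo = -‿homo
    ; 0-homo = refl
    ; 1-homo = refl
    }

  private
    _≟ᶻ_ : WeaklyDecidable (Induced-equivalence ℤ⟶R)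
    i ≟ᶻ j with i ℤ.≟ j
    ... | yes ≡.refl = just refl
    ... | no _ = nothing

  open import Algebra.Solver.Ring ℤ.+-*-rawRing (fromCommutativeRing R) ℤ⟶R _≟ᶻ_ public

  x-y≈0⇒x≈y : ∀ {x y} → x - y ≈ 0# → x ≈ y
  x-y≈0⇒x≈y = x∙y⁻¹≈ε⇒x≈y _ _

  x≈y⇒x-y≈0 : ∀ {x y} → x ≈ y → x - y ≈ 0#
  x≈y⇒x-y≈0 = x≈y⇒x∙y⁻¹≈ε

  -- l ≈ r follows from hypotheses pᵢ ≈ qᵢ once l - r is exhibited as Σ kᵢ * (pᵢ - qᵢ);
  -- that certificate is a ring identity, left to the solver.
  private
    k*[p-q]≈0 : ∀ k {p q} → p ≈ q → k * (p - q) ≈ 0#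
    k*[p-q]≈0 k p≈q = trans (*-congˡ (x≈y⇒x-y≈0 p≈q)) (zeroʳ k)

  combination₁ : ∀ {l r} k {p q} → l - r ≈ k * (p - q) → p ≈ q → l ≈ r
  combination₁ k eq p≈q = x-y≈0⇒x≈y (trans eq (k*[p-q]≈0 k p≈q))

  combination₂ : ∀ {l r} k₁ {p₁ q₁} k₂ {p₂ q₂} →
                 l - r ≈ k₁ * (p₁ - q₁) + k₂ * (p₂ - q₂) →
                 p₁ ≈ q₁ → p₂ ≈ q₂ → l ≈ r
  combination₂ k₁ k₂ eq e₁ e₂ = x-y≈0⇒x≈y
    (trans eq (trans (+-cong (k*[p-q]≈0 k₁ e₁) (k*[p-q]≈0 k₂ e₂)) (+-identityʳ 0#)))

  combination₃ : ∀ {l r} k₁ {p₁ q₁} k₂ {p₂ q₂} k₃ {p₃ q₃} →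
                 l - r ≈ k₁ * (p₁ - q₁) + k₂ * (p₂ - q₂) + k₃ * (p₃ - q₃) →
                 p₁ ≈ q₁ → p₂ ≈ q₂ → p₃ ≈ q₃ → l ≈ r
  combination₃ k₁ k₂ k₃ eq e₁ e₂ e₃ = x-y≈0⇒x≈y
    (trans eq (trans (+-cong (+-cong (k*[p-q]≈0 k₁ e₁) (k*[p-q]≈0 k₂ e₂)) (k*[p-q]≈0 k₃ e₃))
                     (trans (+-identityʳ _) (+-identityʳ 0#))))


module Counting {A : Set} {_≈_ : Rel A 0ℓ} (isEquivalence : IsEquivalence _≈_) (_≟_ : B.Decidable _≈_)
  (xs : List A) (complete : ∀ x → Any (x ≈_) xs) (distinct : AllPairs (λ x y → ¬ x ≈ y) xs) where
  open import Data.Nat.Base using (zero; suc; _+_; _*_; _≤_; _<_; z≤n; s≤s)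
  import Data.Nat.Properties as ℕ
  open import Data.List.Base using ([]; _∷_; filter)
  open import Data.List.Properties using (filter-≐; filter-none; filter-some)
  open import Data.List.Relation.Unary.Any as Any using (here; there; any?)
  open import Data.List.Relation.Unary.All as All using (All; _∷_)
  open import Data.List.Relation.Unary.AllPairs using ([]; _∷_)
  open import Data.Product using (_×_; _,_; proj₁; proj₂; ∃)
  open import Relation.Nullary using (yes; no)
  open import Relation.Nullary.Negation using (contradiction)
  open import Relation.Nullary.Decidable using (_×-dec_)
  open import Relation.Unary using (Pred; Decidable; _≐_)
  open import Relation.Unary.Properties using (_∩?_; ∁?)
  open import Relation.Binary.PropositionalEquality using (refl; sym; trans; cong; subst; module ≡-Reasoning)

  open IsEquivalence isEquivalence using () renaming (sym to ≈-sym; trans to ≈-trans)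
  open ≡-Reasoning

  count : {P : Pred A 0ℓ} → Decidable P → ℕ
  count P? = length (filter P? xs)

  _∈ₛ_ : A → List A → Set
  x ∈ₛ ys = Any (x ≈_) ys

  ≈? : ∀ a → Decidable (_≈ a)
  ≈? a x = x ≟ a

  ∈ₛ? : ∀ ys → Decidable (_∈ₛ ys)
  ∈ₛ? ys x = any? (x ≟_) ys

  private
    variable
      P Q : Pred A 0ℓ

    length-filter-split : (P? : Decidable P) (Q? : Decidable Q) → ∀ ys →
      length (filter P? ys) ≡ length (filter (P? ∩? Q?) ys) + length (filter (P? ∩? ∁? Q?) ys)
    length-filter-split P? Q? [] = refl
    length-filter-split P? Q? (y ∷ ys) with P? y | Q? y
    ... | yes _ | yes _ = cong suc (length-filter-split P? Q? ys)
    ... | yes _ | no _ = trans (cong suc (length-filter-split P? Q? ys)) (sym (ℕ.+-suc _ _))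
    ... | no _ | _ = length-filter-split P? Q? ys

    length-filter-complement : (P? : Decidable P) → ∀ ys →
      length (filter P? ys) + length (filter (∁? P?) ys) ≡ length ys
    length-filter-complement P? [] = refl
    length-filter-complement P? (y ∷ ys) with P? y
    ... | yes _ = cong suc (length-filter-complement P? ys)
    ... | no _ = trans (ℕ.+-suc _ _) (cong suc (length-filter-complement P? ys))

    filter-nonempty : (P? : Decidable P) → ∀ ys → 0 < length (filter P? ys) →
                      ∃ λ t → P t × Any (t ≡_) ys
    filter-nonempty P? (y ∷ ys) pos with P? y
    ... | yes py = y , py , here refl
    ... | no _ with filter-nonempty P? ys pos
    ...   | t , pt , t∈ys = t , pt , there t∈ys

    ≉-all-∉ : ∀ {x y ys} → All (λ z → ¬ y ≈ z) ys → x ≈ y → ¬ x ∈ₛ ys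
    ≉-all-∉ (y≉z ∷ _) x≈y (here x≈z) = y≉z (≈-trans (≈-sym x≈y) x≈z)
    ≉-all-∉ (_ ∷ y≉zs) x≈y (there x∈ys) = ≉-all-∉ y≉zs x≈y x∈ys

  count-split : (P? : Decidable P) (Q? : Decidable Q) →
                count P? ≡ count (P? ∩? Q?) + count (P? ∩? ∁? Q?)
  count-split P? Q? = length-filter-split P? Q? xs

  count-complement : (P? : Decidable P) → count P? + count (∁? P?) ≡ length xs
  count-complement P? = length-filter-complement P? xs

  count-cong : (P? : Decidable P) (Q? : Decidable Q) → P ≐ Q → count P? ≡ count Q?
  count-cong P? Q? P≐Q = cong length (filter-≐ P? Q? P≐Q xs)

  count-empty : (P? : Decidable P) → (∀ x → ¬ P x) → count P? ≡ 0
  count-empty P? ¬P = cong length (filter-none P? {xs} (All.tabulate (λ {x} _ → ¬P x)))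

  count-singleton : ∀ a → count (≈? a) ≡ 1
  count-singleton a = go xs distinct (complete a)
    where
    go : ∀ ys → AllPairs (λ x y → ¬ x ≈ y) ys → a ∈ₛ ys → length (filter (≈? a) ys) ≡ 1
    go (y ∷ ys) (y≉ys ∷ _) (here a≈y) with y ≟ a
    ... | yes _ = cong suc (cong length (filter-none (≈? a)
                    (All.map (λ y≉z z≈a → y≉z (≈-trans (≈-sym a≈y) (≈-sym z≈a))) y≉ys)))
    ... | no y≉a = contradiction (≈-sym a≈y) y≉a
    go (y ∷ ys) (y≉ys ∷ ys-distinct) (there a∈ys) with y ≟ a
    ... | yes y≈a = contradiction a∈ys (≉-all-∉ y≉ys (≈-sym y≈a))
    ... | no _ = go ys ys-distinct a∈ys

  count-remove : (Q? : Decidable Q) → ∀ a → (∀ {x} → x ≈ a → Q x) →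
                 count Q? ≡ suc (count (Q? ∩? ∁? (≈? a)))
  count-remove Q? a ≈a⇒Q = trans (count-split Q? (≈? a)) (cong (_+ count (Q? ∩? ∁? (≈? a)))
    (trans (count-cong (Q? ∩? (≈? a)) (≈? a) (proj₂ , λ x≈a → ≈a⇒Q x≈a , x≈a)) (count-singleton a)))

  count-listed : ∀ ps → AllPairs (λ x y → ¬ x ≈ y) ps → count (∈ₛ? ps) ≡ length ps
  count-listed [] [] = count-empty (∈ₛ? []) (λ _ ())
  count-listed (p ∷ ps) (p≉ps ∷ ps-distinct) =
    trans (count-remove (∈ₛ? (p ∷ ps)) p here)
          (cong suc (trans (count-cong _ (∈ₛ? ps) (drop-p , keep)) (count-listed ps ps-distinct)))
    where
    drop-p : ∀ {x} → x ∈ₛ (p ∷ ps) × ¬ x ≈ p → x ∈ₛ ps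
    drop-p (here x≈p , x≉p) = contradiction x≈p x≉p
    drop-p (there x∈ps , _) = x∈ps
    keep : ∀ {x} → x ∈ₛ ps → x ∈ₛ (p ∷ ps) × ¬ x ≈ p
    keep x∈ps = there x∈ps , λ x≈p → ≉-all-∉ p≉ps x≈p x∈ps

  module Fibres (f : A → A) where

    Image : Pred A 0ℓ → Pred A 0ℓ
    Image P s = Any (λ t → P t × f t ≈ s) xs

    image? : Decidable P → Decidable (Image P)
    image? P? s = any? (λ t → P? t ×-dec (f t ≟ s)) xs

    fibre? : ∀ t → Decidable (λ x → f x ≈ f t)
    fibre? t x = f x ≟ f t

    Fibred : Decidable P → ℕ → Set
    Fibred {P} P? n = ∀ t → P t → count (P? ∩? fibre? t) ≡ n

    count-fibres : ∀ m (P? : Decidable P) → Fibred P? (suc m) → count P? ≡ suc m * count (image? P?)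
    count-fibres m P? = go _ P? ℕ.≤-refl
      where
      no-image : (P? : Decidable P) → count P? ≡ 0 → suc m * count (image? P?) ≡ 0
      no-image {P} P? empty = trans (cong (suc m *_) (count-empty (image? P?) ∉image)) (ℕ.*-zeroʳ (suc m))
        where
        ∉image : ∀ s → ¬ Image P s
        ∉image s im = ℕ.n≮0 (subst (0 <_) empty (filter-some P? (Any.map proj₁ im)))

      -- Induction on a bound for count P?: remove the fibre of an element of P and its image point.
      go : ∀ n (P? : Decidable P) → count P? ≤ n → Fibred P? (suc m) → count P? ≡ suc m * count (image? P?)
      go zero P? bound _ = trans (ℕ.n≤0⇒n≡0 bound) (sym (no-image P? (ℕ.n≤0⇒n≡0 bound)))
      go (suc n) P? bound fibred with count P? in eq
      ... | zero = sym (no-image P? eq)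
      ... | suc k with filter-nonempty P? xs (subst (0 <_) (sym eq) (s≤s z≤n))
      ...   | t , pt , t∈xs = begin
        suc k                                ≡⟨ count-minus-fibre ⟨
        suc m + count P′?                    ≡⟨ cong (suc m +_) (go n P′? bound′ fibred′) ⟩
        suc m + suc m * count (image? P′?)   ≡⟨ ℕ.*-suc (suc m) _ ⟨
        suc m * suc (count (image? P′?))     ≡⟨ cong (suc m *_) image-minus-point ⟨
        suc m * count (image? P?)            ∎
        where
        P′? = P? ∩? ∁? (fibre? t)

        count-minus-fibre : suc m + count P′? ≡ suc k
        count-minus-fibre = trans (cong (_+ count P′?) (sym (fibred t pt)))
                                  (trans (sym (count-split P? (fibre? t))) eq)

        bound′ : count P′? ≤ n
        bound′ = ℕ.≤-pred (ℕ.≤-trans (s≤s (ℕ.m≤n+m _ m)) (subst (_≤ suc n) (sym count-minus-fibre) bound))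

        fibred′ : Fibred P′? (suc m)
        fibred′ t′ (pt′ , ft′≉ft) = trans (count-cong _ (P? ∩? fibre? t′)
            ((λ ((px , _) , fx≈ft′) → px , fx≈ft′) ,
             (λ (px , fx≈ft′) → (px , λ fx≈ft → ft′≉ft (≈-trans (≈-sym fx≈ft′) fx≈ft)) , fx≈ft′)))
          (fibred t′ pt′)

        image-minus-point : count (image? P?) ≡ suc (count (image? P′?))
        image-minus-point = trans
          (count-remove (image? P?) (f t) (λ s≈ft → Any.map (λ { refl → pt , ≈-sym s≈ft }) t∈xs))
          (cong suc (count-cong _ (image? P′?) (shrink , grow)))
          where
          shrink : ∀ {s} → Image _ s × ¬ s ≈ f t → Image _ s
          shrink (im , s≉ft) = Any.map (λ (pt′ , ft′≈s) →
            (pt′ , λ ft′≈ft → s≉ft (≈-trans (≈-sym ft′≈s) ft′≈ft)) , ft′≈s) im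
          grow : ∀ {s} → Image _ s → Image _ s × ¬ s ≈ f t
          grow im = Any.map (λ ((pt′ , _) , ft′≈s) → pt′ , ft′≈s) im ,
                    λ s≈ft → let (_ , (_ , ft′≉ft) , ft′≈s) = Any.satisfied im
                             in ft′≉ft (≈-trans ft′≈s s≈ft)


module DiscreteField (R : CommutativeRing 0ℓ 0ℓ) (_≟_ : B.Decidable (CommutativeRing._≈_ R))
         (isField : Mat.IsField R) where
  open import Data.Integer.Base using (+_)
  open import Data.Product using (_×_; _,_; proj₁; proj₂)
  open import Data.Sum using (_⊎_; inj₁; inj₂; [_,_]′)
  open import Relation.Nullary using (Dec; yes; no)
  open import Relation.Nullary.Negation using (contradiction)

  open CommutativeRing R
  open Mat R using (IsSquare)
  open IntegerSolver R public
    using (solve; _:=_; _:+_; _:*_; _:-_; :-_; con; x-y≈0⇒x≈y; x≈y⇒x-y≈0; combination₁; combination₂; combination₃)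

  2# : Carrier
  2# = 1# + 1#

  0≉1 : ¬ 0# ≈ 1#
  0≉1 = proj₁ isField

  1≉0 : ¬ 1# ≈ 0#
  1≉0 1≈0 = 0≉1 (sym 1≈0)

  -- 0# ⁻¹ is the junk value 0#.
  _⁻¹ : Carrier → Carrier
  x ⁻¹ with x ≟ 0#
  ... | yes _ = 0#
  ... | no x≉0 = proj₁ (proj₂ isField x x≉0)

  ⁻¹-inverseʳ : ∀ {x} → ¬ x ≈ 0# → x * x ⁻¹ ≈ 1#
  ⁻¹-inverseʳ {x} x≉0 with x ≟ 0#
  ... | yes x≈0 = contradiction x≈0 x≉0
  ... | no x≉0′ = proj₂ (proj₂ isField x x≉0′)

  ⁻¹-inverseˡ : ∀ {x} → ¬ x ≈ 0# → x ⁻¹ * x ≈ 1#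
  ⁻¹-inverseˡ x≉0 = trans (*-comm _ _) (⁻¹-inverseʳ x≉0)

  zero-product : ∀ {x y} → x * y ≈ 0# → x ≈ 0# ⊎ y ≈ 0#
  zero-product {x} {y} xy≈0 with x ≟ 0#
  ... | yes x≈0 = inj₁ x≈0
  ... | no x≉0 = inj₂ (combination₂ y (x ⁻¹) (solve 3 (λ x y x⁻¹ →
          y :- con (+ 0) := y :* (con (+ 1) :- x⁻¹ :* x) :+ x⁻¹ :* (x :* y :- con (+ 0))) refl x y (x ⁻¹))
          (sym (⁻¹-inverseˡ x≉0)) xy≈0)

  *-nonzero : ∀ {x y} → ¬ x ≈ 0# → ¬ y ≈ 0# → ¬ x * y ≈ 0#
  *-nonzero x≉0 y≉0 xy≈0 with zero-product xy≈0
  ... | inj₁ x≈0 = x≉0 x≈0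
  ... | inj₂ y≈0 = y≉0 y≈0

  square≈0⇒≈0 : ∀ {x} → x * x ≈ 0# → x ≈ 0#
  square≈0⇒≈0 xx≈0 with zero-product xx≈0
  ... | inj₁ x≈0 = x≈0
  ... | inj₂ x≈0 = x≈0

  *-cancelˡ : ∀ {k x y} → ¬ k ≈ 0# → k * x ≈ k * y → x ≈ y
  *-cancelˡ {k} {x} {y} k≉0 kx≈ky with zero-product (combination₁ 1# (solve 3 (λ k x y →
      k :* (x :- y) :- con (+ 0) := con (+ 1) :* (k :* x :- k :* y)) refl k x y) kx≈ky)
  ... | inj₁ k≈0 = contradiction k≈0 k≉0
  ... | inj₂ x-y≈0 = x-y≈0⇒x≈y x-y≈0

  *-cancelʳ : ∀ {k x y} → ¬ k ≈ 0# → x * k ≈ y * k → x ≈ y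
  *-cancelʳ {k} {x} {y} k≉0 xk≈yk = *-cancelˡ k≉0 (trans (*-comm k x) (trans xk≈yk (*-comm y k)))

  square-injective : ∀ {x y} → x * x ≈ y * y → x ≈ y ⊎ x ≈ - y
  square-injective {x} {y} xx≈yy with zero-product (combination₁ 1# (solve 2 (λ x y →
      (x :- y) :* (x :+ y) :- con (+ 0) := con (+ 1) :* (x :* x :- y :* y)) refl x y) xx≈yy)
  ... | inj₁ x-y≈0 = inj₁ (x-y≈0⇒x≈y x-y≈0)
  ... | inj₂ x+y≈0 = inj₂ (combination₁ 1# (solve 2 (λ x y →
      x :- :- y := con (+ 1) :* ((x :+ y) :- con (+ 0))) refl x y) x+y≈0)

  -‿nonzero : ∀ {x} → ¬ x ≈ 0# → ¬ - x ≈ 0#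
  -‿nonzero {x} x≉0 -x≈0 = x≉0 (combination₁ (- 1#) (solve 1 (λ x →
      x :- con (+ 0) := :- con (+ 1) :* (:- x :- con (+ 0))) refl x) -x≈0)

  *≈1⇒≉0 : ∀ {x y} → x * y ≈ 1# → ¬ x ≈ 0#
  *≈1⇒≉0 {x} {y} xy≈1 x≈0 = 0≉1 (trans (sym (trans (*-congʳ x≈0) (zeroˡ y))) xy≈1)

  ⁻¹-unique : ∀ {x y} → x * y ≈ 1# → x ⁻¹ ≈ y
  ⁻¹-unique {x} {y} xy≈1 = combination₂ (- x ⁻¹) y (solve 3 (λ x⁻¹ y x →
      x⁻¹ :- y := :- x⁻¹ :* (x :* y :- con (+ 1)) :+ y :* (x⁻¹ :* x :- con (+ 1))) refl (x ⁻¹) y x)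
    xy≈1 (⁻¹-inverseˡ (*≈1⇒≉0 xy≈1))

  ⁻¹-nonzero : ∀ {x} → ¬ x ≈ 0# → ¬ x ⁻¹ ≈ 0#
  ⁻¹-nonzero x≉0 = *≈1⇒≉0 (⁻¹-inverseˡ x≉0)

  ⁻¹-of-zero : ∀ {x} → x ≈ 0# → x ⁻¹ ≈ 0#
  ⁻¹-of-zero {x} x≈0 with x ≟ 0#
  ... | yes _ = refl
  ... | no x≉0 = contradiction x≈0 x≉0

  ⁻¹-cong : ∀ {x y} → x ≈ y → x ⁻¹ ≈ y ⁻¹
  ⁻¹-cong {x} {y} x≈y = by-cases (y ≟ 0#)
    where
    by-cases : Dec (y ≈ 0#) → x ⁻¹ ≈ y ⁻¹
    by-cases (yes y≈0) = trans (⁻¹-of-zero (trans x≈y y≈0)) (sym (⁻¹-of-zero y≈0))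
    by-cases (no y≉0) = ⁻¹-unique (trans (*-congʳ x≈y) (⁻¹-inverseʳ y≉0))

  ⁻¹-involutive : ∀ {x} → ¬ x ≈ 0# → x ⁻¹ ⁻¹ ≈ x
  ⁻¹-involutive x≉0 = ⁻¹-unique (⁻¹-inverseˡ x≉0)

  -‿⁻¹ : ∀ {x} → ¬ x ≈ 0# → (- x) ⁻¹ ≈ - x ⁻¹
  -‿⁻¹ {x} x≉0 = ⁻¹-unique (trans (solve 2 (λ x x⁻¹ → :- x :* :- x⁻¹ := x :* x⁻¹) refl x (x ⁻¹))
                                  (⁻¹-inverseʳ x≉0))

  -x≈y⇒x≈-y : ∀ {x y} → - x ≈ y → x ≈ - y
  -x≈y⇒x≈-y {x} {y} = combination₁ (- 1#) (solve 2 (λ x y → x :- :- y := :- con (+ 1) :* (:- x :- y)) refl x y)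

  -‿injective : ∀ {x y} → - x ≈ - y → x ≈ y
  -‿injective {x} {y} -x≈-y = trans (-x≈y⇒x≈-y -x≈-y) (solve 1 (λ y → :- :- y := y) refl y)

  [-1]²≈1 : - 1# * - 1# ≈ 1#
  [-1]²≈1 = solve 0 (:- con (+ 1) :* :- con (+ 1) := con (+ 1)) refl

  x²≈1⇒x≈±1 : ∀ {x} → x * x ≈ 1# → x ≈ 1# ⊎ x ≈ - 1#
  x²≈1⇒x≈±1 x²≈1 = square-injective (trans x²≈1 (sym (*-identityˡ 1#)))

  square-separates : ∀ {x y u v} → x * x ≈ u → y * y ≈ v → ¬ u ≈ v → ¬ x ≈ y
  square-separates x²≈u y²≈v u≉v x≈y = u≉v (trans (sym x²≈u) (trans (*-cong x≈y x≈y) y²≈v))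

  NonzeroSquare : Carrier → Set
  NonzeroSquare x = ¬ x ≈ 0# × IsSquare x

  ConsecutiveSquares : Carrier → Set
  ConsecutiveSquares s = NonzeroSquare s × NonzeroSquare (s - 1#)

  NonzeroSquare-cong : ∀ {x y} → x ≈ y → NonzeroSquare x → NonzeroSquare y
  NonzeroSquare-cong x≈y (x≉0 , z , z²≈x) = (λ y≈0 → x≉0 (trans x≈y y≈0)) , z , trans z²≈x x≈y

  ConsecutiveSquares-cong : ∀ {s s′} → s ≈ s′ → ConsecutiveSquares s → ConsecutiveSquares s′
  ConsecutiveSquares-cong s≈s′ (s∈□ , s-1∈□) =
    NonzeroSquare-cong s≈s′ s∈□ , NonzeroSquare-cong (+-congʳ s≈s′) s-1∈□

  module CharacteristicNot2 (2≉0 : ¬ 2# ≈ 0#) where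

    x≈-x⇒x≈0 : ∀ {x} → x ≈ - x → x ≈ 0#
    x≈-x⇒x≈0 {x} x≈-x with zero-product (combination₁ 1# (solve 1 (λ x →
        (con (+ 2)) :* x :- con (+ 0) := con (+ 1) :* (x :- :- x)) refl x) x≈-x)
    ... | inj₁ 2≈0 = contradiction 2≈0 2≉0
    ... | inj₂ x≈0 = x≈0

    x≉0⇒x≉-x : ∀ {x} → ¬ x ≈ 0# → ¬ x ≈ - x
    x≉0⇒x≉-x x≉0 x≈-x = x≉0 (x≈-x⇒x≈0 x≈-x)

    1≉-1 : ¬ 1# ≈ - 1#
    1≉-1 = x≉0⇒x≉-x 1≉0

    ½ : Carrier
    ½ = 2# ⁻¹

    2*½≈1 : 2# * ½ ≈ 1#
    2*½≈1 = ⁻¹-inverseʳ 2≉0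

    ½≉0 : ¬ ½ ≈ 0#
    ½≉0 = ⁻¹-nonzero 2≉0

    joukowski joukowski⁻ : Carrier → Carrier
    joukowski t = (t + t ⁻¹) * ½
    joukowski⁻ t = (t - t ⁻¹) * ½

    joukowski-cong : ∀ {x y} → x ≈ y → joukowski x ≈ joukowski y
    joukowski-cong x≈y = *-congʳ (+-cong x≈y (⁻¹-cong x≈y))

    joukowski-⁻¹ : ∀ {t} → ¬ t ≈ 0# → joukowski (t ⁻¹) ≈ joukowski t
    joukowski-⁻¹ t≉0 = *-congʳ (trans (+-congˡ (⁻¹-involutive t≉0)) (+-comm _ _))

    joukowski-‿ : ∀ {t} → ¬ t ≈ 0# → joukowski (- t) ≈ - joukowski t
    joukowski-‿ {t} t≉0 = trans (*-congʳ (+-congˡ (-‿⁻¹ t≉0)))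
      (solve 3 (λ t t⁻¹ ½ → (:- t :+ :- t⁻¹) :* ½ := :- ((t :+ t⁻¹) :* ½)) refl t (t ⁻¹) ½)

    joukowski²-joukowski⁻²≈1 : ∀ {t} → ¬ t ≈ 0# →
      joukowski t * joukowski t - 1# ≈ joukowski⁻ t * joukowski⁻ t
    joukowski²-joukowski⁻²≈1 {t} t≉0 = combination₂ ((2# * ½) * (2# * ½)) (2# * ½ + 1#)
      (solve 3 (λ t t⁻¹ ½ →
        ((t :+ t⁻¹) :* ½) :* ((t :+ t⁻¹) :* ½) :- con (+ 1) :- ((t :- t⁻¹) :* ½) :* ((t :- t⁻¹) :* ½)
        := (con (+ 2) :* ½) :* (con (+ 2) :* ½) :* (t :* t⁻¹ :- con (+ 1))
           :+ (con (+ 2) :* ½ :+ con (+ 1)) :* (con (+ 2) :* ½ :- con (+ 1))) refl t (t ⁻¹) ½)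
      (⁻¹-inverseʳ t≉0) 2*½≈1

    -- t + t′ = x + x′ with t t′ = x x′ = 1 forces (t - x)(t x - 1) = 0.
    sum-with-inverse-injective : ∀ {t t′ x x′} → t * t′ ≈ 1# → x * x′ ≈ 1# →
                                 t + t′ ≈ x + x′ → x ≈ t ⊎ x ≈ t′
    sum-with-inverse-injective {t} {t′} {x} {x′} tt′≈1 xx′≈1 eq
      with zero-product (combination₃ (t * x) (- x) t (solve 4 (λ t x t′ x′ →
             (t :- x) :* (t :* x :- con (+ 1)) :- con (+ 0)
             := (t :* x) :* ((t :+ t′) :- (x :+ x′)) :+ :- x :* (t :* t′ :- con (+ 1))
                :+ t :* (x :* x′ :- con (+ 1))) refl t x t′ x′) eq tt′≈1 xx′≈1)
    ... | inj₁ t-x≈0 = inj₁ (sym (x-y≈0⇒x≈y t-x≈0))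
    ... | inj₂ tx-1≈0 = inj₂ (combination₂ t′ (- x) (solve 3 (λ x t′ t →
          x :- t′ := t′ :* (t :* x :- con (+ 1)) :+ :- x :* (t :* t′ :- con (+ 1))) refl x t′ t)
          (x-y≈0⇒x≈y tx-1≈0) tt′≈1)

    joukowski-fibre : ∀ {t x} → ¬ t ≈ 0# → ¬ x ≈ 0# → joukowski x ≈ joukowski t → x ≈ t ⊎ x ≈ t ⁻¹
    joukowski-fibre t≉0 x≉0 Jx≈Jt =
      sum-with-inverse-injective (⁻¹-inverseʳ t≉0) (⁻¹-inverseʳ x≉0) (sym (*-cancelʳ ½≉0 Jx≈Jt))

    joukowski²-fibre : ∀ {t x} → ¬ t ≈ 0# → ¬ x ≈ 0# →
      joukowski x * joukowski x ≈ joukowski t * joukowski t →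
      x ≈ t ⊎ x ≈ - t ⊎ x ≈ t ⁻¹ ⊎ x ≈ - t ⁻¹
    joukowski²-fibre {t} {x} t≉0 x≉0 eq with square-injective eq
    ... | inj₁ Jx≈Jt = [ inj₁ , (λ x≈t⁻¹ → inj₂ (inj₂ (inj₁ x≈t⁻¹))) ]′ (joukowski-fibre t≉0 x≉0 Jx≈Jt)
    ... | inj₂ Jx≈-Jt =
      [ (λ x≈-t → inj₂ (inj₁ x≈-t)) , (λ x≈[-t]⁻¹ → inj₂ (inj₂ (inj₂ (trans x≈[-t]⁻¹ (-‿⁻¹ t≉0))))) ]′
        (joukowski-fibre (-‿nonzero t≉0) x≉0 (trans Jx≈-Jt (sym (joukowski-‿ t≉0))))

    joukowski-of-sum : ∀ {a b} → a * a - b * b ≈ 1# → joukowski (a + b) ≈ a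
    joukowski-of-sum {a} {b} a²-b²≈1 = trans (*-congʳ (+-congˡ [a+b]⁻¹≈a-b))
      (combination₁ a (solve 3 (λ a b ½ → ((a :+ b) :+ (a :- b)) :* ½ :- a := a :* (con (+ 2) :* ½ :- con (+ 1)))
                               refl a b ½) 2*½≈1)
      where
      [a+b]⁻¹≈a-b : (a + b) ⁻¹ ≈ a - b
      [a+b]⁻¹≈a-b = ⁻¹-unique (trans (solve 2 (λ a b → (a :+ b) :* (a :- b) := a :* a :- b :* b) refl a b) a²-b²≈1)

    joukowski≈0⇒t²≈-1 : ∀ {t} → ¬ t ≈ 0# → joukowski t ≈ 0# → t * t ≈ - 1#
    joukowski≈0⇒t²≈-1 {t} t≉0 Jt≈0 with zero-product Jt≈0
    ... | inj₂ ½≈0 = contradiction ½≈0 ½≉0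
    ... | inj₁ t+t⁻¹≈0 = combination₂ t (- 1#) (solve 2 (λ t t⁻¹ →
          t :* t :- :- con (+ 1) := t :* ((t :+ t⁻¹) :- con (+ 0)) :+ :- con (+ 1) :* (t :* t⁻¹ :- con (+ 1)))
          refl t (t ⁻¹)) t+t⁻¹≈0 (⁻¹-inverseʳ t≉0)

    joukowski⁻≈0⇒t²≈1 : ∀ {t} → ¬ t ≈ 0# → joukowski⁻ t ≈ 0# → t * t ≈ 1#
    joukowski⁻≈0⇒t²≈1 {t} t≉0 Kt≈0 with zero-product Kt≈0
    ... | inj₂ ½≈0 = contradiction ½≈0 ½≉0
    ... | inj₁ t-t⁻¹≈0 = combination₂ t 1# (solve 2 (λ t t⁻¹ →
          t :* t :- con (+ 1) := t :* ((t :- t⁻¹) :- con (+ 0)) :+ con (+ 1) :* (t :* t⁻¹ :- con (+ 1)))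
          refl t (t ⁻¹)) t-t⁻¹≈0 (⁻¹-inverseʳ t≉0)


module FiniteField (R : CommutativeRing 0ℓ 0ℓ) (_≟_ : B.Decidable (CommutativeRing._≈_ R))
  (isField : Mat.IsField R) (xs : List (CommutativeRing.Carrier R))
  (complete : ∀ x → Any (CommutativeRing._≈_ R x) xs)
  (distinct : AllPairs (λ x y → ¬ CommutativeRing._≈_ R x y) xs)
  {m : ℕ} (|R|≡4m+1 : length xs ≡ 4 ℕ.* m ℕ.+ 1) where
  open import Data.Integer.Base using (+_)
  open import Data.Nat.Base using (_∸_; _/_)
  open import Data.List.Base using ([]; _∷_)
  open import Data.List.Properties using (filter-all)
  open import Data.List.Relation.Unary.Any as Any using (here; there; any?)
  open import Data.List.Relation.Unary.All as All using ([]; _∷_)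
  open import Data.List.Relation.Unary.AllPairs using ([]; _∷_)
  open import Data.Product using (∃; _×_; _,_; proj₁; proj₂)
  open import Data.Sum using (_⊎_; inj₁; inj₂; [_,_]′)
  open import Relation.Nullary using (yes; no)
  open import Relation.Nullary.Negation using (contradiction)
  open import Relation.Nullary.Decidable using (_×-dec_; ¬?)
  open import Relation.Unary using (U; _≐_; Decidable)
  open import Relation.Unary.Properties using (∁?; U?; _∩?_)
  import Relation.Binary.PropositionalEquality as ≡
  open ModFour

  open CommutativeRing R
  open Mat R using (IsSquare)
  open DiscreteField R _≟_ isField
  open Counting isEquivalence _≟_ xs complete distinct

  private
    count-U : count U? ≡ 4 ℕ.* m ℕ.+ 1
    count-U = ≡.trans (≡.cong length (filter-all U? (All.universal _ xs))) |R|≡4m+1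

  -- In characteristic 2 the map y ↦ y (y + 1) would be exactly 2-to-1, making |R| even.
  2≉0 : ¬ 2# ≈ 0#
  2≉0 2≈0 = 4c+1≢2x m (count (image? U?)) (≡.trans (≡.sym count-U) (count-fibres 1 U? pair-fibre))
    where
    open Fibres (λ y → y * (y + 1#))

    t≉t+1 : ∀ t → ¬ t ≈ t + 1#
    t≉t+1 t t≈t+1 = 0≉1 (sym (combination₁ (- 1#) (solve 1 (λ t →
      con (+ 1) :- con (+ 0) := :- con (+ 1) :* (t :- (t :+ con (+ 1)))) refl t) t≈t+1))

    pair-fibre : ∀ t → U t → count (U? ∩? fibre? t) ≡ 2
    pair-fibre t _ = ≡.trans (count-cong _ (∈ₛ? (t ∷ t + 1# ∷ [])) (in-pair , on-fibre))
                             (count-listed _ ((t≉t+1 t ∷ []) ∷ [] ∷ []))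
      where
      in-pair : ∀ {x} → U x × x * (x + 1#) ≈ t * (t + 1#) → x ∈ₛ (t ∷ t + 1# ∷ [])
      in-pair {x} (_ , eq) with zero-product (combination₁ 1# (solve 2 (λ x t →
          (x :- t) :* (x :+ t :+ con (+ 1)) :- con (+ 0)
          := con (+ 1) :* (x :* (x :+ con (+ 1)) :- t :* (t :+ con (+ 1)))) refl x t) eq)
      ... | inj₁ x-t≈0 = here (x-y≈0⇒x≈y x-t≈0)
      ... | inj₂ x+t+1≈0 = there (here (combination₂ 1# (- (t + 1#)) (solve 2 (λ x t →
          x :- (t :+ con (+ 1)) := con (+ 1) :* ((x :+ t :+ con (+ 1)) :- con (+ 0))
                                   :+ :- (t :+ con (+ 1)) :* (con (+ 2) :- con (+ 0)))
          refl x t) x+t+1≈0 2≈0))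
      on-fibre : ∀ {x} → x ∈ₛ (t ∷ t + 1# ∷ []) → U x × x * (x + 1#) ≈ t * (t + 1#)
      on-fibre (here x≈t) = _ , *-cong x≈t (+-congʳ x≈t)
      on-fibre (there (here x≈t+1)) = _ , trans (*-cong x≈t+1 (+-congʳ x≈t+1))
        (combination₁ (t + 1#) (solve 1 (λ t →
          (t :+ con (+ 1)) :* (t :+ con (+ 1) :+ con (+ 1)) :- t :* (t :+ con (+ 1))
          := (t :+ con (+ 1)) :* (con (+ 2) :- con (+ 0))) refl t) 2≈0)

  open CharacteristicNot2 2≉0

  Admissible : Carrier → Set
  Admissible t = ¬ t ≈ 0# × ¬ t * t ≈ 1# × ¬ t * t ≈ - 1#

  admissible? : Decidable Admissible
  admissible? t = ¬? (t ≟ 0#) ×-dec ¬? ((t * t) ≟ 1#) ×-dec ¬? ((t * t) ≟ (- 1#))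

  admissible-cong : ∀ {x y} → x ≈ y → Admissible x → Admissible y
  admissible-cong x≈y (x≉0 , x²≉1 , x²≉-1) =
    (λ y≈0 → x≉0 (trans x≈y y≈0)) , (λ y²≈1 → x²≉1 (trans (*-cong x≈y x≈y) y²≈1)) ,
    (λ y²≈-1 → x²≉-1 (trans (*-cong x≈y x≈y) y²≈-1))

  admissible-‿ : ∀ {t} → Admissible t → Admissible (- t)
  admissible-‿ {t} (t≉0 , t²≉1 , t²≉-1) =
    -‿nonzero t≉0 , (λ eq → t²≉1 (trans [-t]²≈t² eq)) , (λ eq → t²≉-1 (trans [-t]²≈t² eq))
    where
    [-t]²≈t² : t * t ≈ - t * - t
    [-t]²≈t² = solve 1 (λ t → t :* t := :- t :* :- t) refl t

  admissible-⁻¹ : ∀ {t} → Admissible t → Admissible (t ⁻¹)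
  admissible-⁻¹ {t} (t≉0 , t²≉1 , t²≉-1) =
    ⁻¹-nonzero t≉0 , (λ eq → t²≉1 (invert 1# (*-identityˡ 1#) eq)) ,
                     (λ eq → t²≉-1 (invert (- 1#) [-1]²≈1 eq))
    where
    invert : ∀ u → u * u ≈ 1# → t ⁻¹ * t ⁻¹ ≈ u → t * t ≈ u
    invert u u²≈1 eq = combination₃ (- (t * t * u)) (- (t * t)) (u * (t * t ⁻¹ + 1#))
      (solve 3 (λ t t⁻¹ u → t :* t :- u
        := :- (t :* t :* u) :* (t⁻¹ :* t⁻¹ :- u) :+ :- (t :* t) :* (u :* u :- con (+ 1))
           :+ (u :* (t :* t⁻¹ :+ con (+ 1))) :* (t :* t⁻¹ :- con (+ 1))) refl t (t ⁻¹) u)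
      eq u²≈1 (⁻¹-inverseʳ t≉0)

  joukowski² : Carrier → Carrier
  joukowski² t = joukowski t * joukowski t

  open Fibres joukowski²

  private
    joukowski²-cong : ∀ {x y} → x ≈ y → joukowski² x ≈ joukowski² y
    joukowski²-cong x≈y = *-cong (joukowski-cong x≈y) (joukowski-cong x≈y)

    joukowski²-‿ : ∀ {t} → ¬ t ≈ 0# → joukowski² (- t) ≈ joukowski² t
    joukowski²-‿ {t} t≉0 = trans (*-cong (joukowski-‿ t≉0) (joukowski-‿ t≉0))
                                  (solve 1 (λ j → :- j :* :- j := j :* j) refl (joukowski t))

    joukowski²-⁻¹ : ∀ {t} → ¬ t ≈ 0# → joukowski² (t ⁻¹) ≈ joukowski² t
    joukowski²-⁻¹ t≉0 = *-cong (joukowski-⁻¹ t≉0) (joukowski-⁻¹ t≉0)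


  quadruple : Carrier → List Carrier
  quadruple t = t ∷ - t ∷ t ⁻¹ ∷ - t ⁻¹ ∷ []

  quadruple-distinct : ∀ {t} → Admissible t → AllPairs (λ x y → ¬ x ≈ y) (quadruple t)
  quadruple-distinct {t} (t≉0 , t²≉1 , t²≉-1) =
      (x≉0⇒x≉-x t≉0 ∷ t≉t⁻¹ ∷ t≉-t⁻¹ ∷ [])
    ∷ ((λ eq → t≉-t⁻¹ (-x≈y⇒x≈-y eq)) ∷ (λ eq → t≉t⁻¹ (-‿injective eq)) ∷ [])
    ∷ (x≉0⇒x≉-x (⁻¹-nonzero t≉0) ∷ [])
    ∷ [] ∷ []
    where
    t≉t⁻¹ : ¬ t ≈ t ⁻¹
    t≉t⁻¹ eq = t²≉1 (trans (*-congˡ eq) (⁻¹-inverseʳ t≉0))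
    t≉-t⁻¹ : ¬ t ≈ - t ⁻¹
    t≉-t⁻¹ eq = t²≉-1 (trans (*-congˡ eq) (trans (solve 2 (λ t t⁻¹ → t :* :- t⁻¹ := :- (t :* t⁻¹)) refl t (t ⁻¹))
                                                    (-‿cong (⁻¹-inverseʳ t≉0))))

  admissible-fibre : ∀ t → Admissible t → count (admissible? ∩? fibre? t) ≡ 4
  admissible-fibre t adm@(t≉0 , _) =
    ≡.trans (count-cong _ (∈ₛ? (quadruple t)) (in-quadruple , on-fibre)) (count-listed _ (quadruple-distinct adm))
    where
    in-quadruple : ∀ {x} → Admissible x × joukowski² x ≈ joukowski² t → x ∈ₛ quadruple t
    in-quadruple ((x≉0 , _) , eq) with joukowski²-fibre t≉0 x≉0 eq
    ... | inj₁ x≈t = here x≈t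
    ... | inj₂ (inj₁ x≈-t) = there (here x≈-t)
    ... | inj₂ (inj₂ (inj₁ x≈t⁻¹)) = there (there (here x≈t⁻¹))
    ... | inj₂ (inj₂ (inj₂ x≈-t⁻¹)) = there (there (there (here x≈-t⁻¹)))
    on-fibre : ∀ {x} → x ∈ₛ quadruple t → Admissible x × joukowski² x ≈ joukowski² t
    on-fibre (here x≈t) = admissible-cong (sym x≈t) adm , joukowski²-cong x≈t
    on-fibre (there (here x≈-t)) =
      admissible-cong (sym x≈-t) (admissible-‿ adm) , trans (joukowski²-cong x≈-t) (joukowski²-‿ t≉0)
    on-fibre (there (there (here x≈t⁻¹))) =
      admissible-cong (sym x≈t⁻¹) (admissible-⁻¹ adm) , trans (joukowski²-cong x≈t⁻¹) (joukowski²-⁻¹ t≉0)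
    on-fibre (there (there (there (here x≈-t⁻¹)))) =
      admissible-cong (sym x≈-t⁻¹) (admissible-‿ (admissible-⁻¹ adm)) ,
      trans (joukowski²-cong x≈-t⁻¹) (trans (joukowski²-‿ (⁻¹-nonzero t≉0)) (joukowski²-⁻¹ t≉0))

  count-admissible : count admissible? ≡ 4 ℕ.* count (image? admissible?)
  count-admissible = count-fibres 3 admissible? admissible-fibre

  private
    count-admissible-complement : ∀ ps → AllPairs (λ x y → ¬ x ≈ y) ps →
      (∀ {x} → x ∈ₛ ps → ¬ Admissible x) → (∀ {x} → ¬ Admissible x → x ∈ₛ ps) →
      count admissible? ℕ.+ length ps ≡ 4 ℕ.* m ℕ.+ 1
    count-admissible-complement ps distinct-ps listed⇒¬adm ¬adm⇒listed = ≡.trans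
      (≡.cong (count admissible? ℕ.+_)
        (≡.sym (≡.trans (count-cong (∁? admissible?) (∈ₛ? ps) (¬adm⇒listed , listed⇒¬adm))
                        (count-listed ps distinct-ps))))
      (≡.trans (count-complement admissible?) |R|≡4m+1)

    non-admissible : ∀ {x} → ¬ Admissible x → x ≈ 0# ⊎ x * x ≈ 1# ⊎ x * x ≈ - 1#
    non-admissible {x} ¬adm with x ≟ 0# | (x * x) ≟ 1# | (x * x) ≟ (- 1#)
    ... | yes x≈0 | _ | _ = inj₁ x≈0
    ... | no _ | yes x²≈1 | _ = inj₂ (inj₁ x²≈1)
    ... | no _ | no _ | yes x²≈-1 = inj₂ (inj₂ x²≈-1)
    ... | no x≉0 | no x²≉1 | no x²≉-1 = contradiction (x≉0 , x²≉1 , x²≉-1) ¬adm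

    0≉-x : ∀ {x} → ¬ x ≈ 0# → ¬ 0# ≈ - x
    0≉-x x≉0 0≈-x = -‿nonzero x≉0 (sym 0≈-x)

    0²≈0 : 0# * 0# ≈ 0#
    0²≈0 = zeroˡ 0#

    1²≈1 : 1# * 1# ≈ 1#
    1²≈1 = *-identityˡ 1#


  √-1 : ∃ λ i → i * i ≈ - 1#
  √-1 with any? (λ y → (y * y) ≟ (- 1#)) xs
  ... | yes found = Any.satisfied found
  ... | no none = contradiction (begin
    4 ℕ.* m ℕ.+ 1                              ≡⟨ count-admissible-complement ps distinct-ps listed⇒¬adm ¬adm⇒listed ⟨
    count admissible? ℕ.+ 3                    ≡⟨ ≡.cong (ℕ._+ 3) count-admissible ⟩
    4 ℕ.* count (image? admissible?) ℕ.+ 3     ∎) (4c+1≢4m+3 m (count (image? admissible?)))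
    where
    open ≡.≡-Reasoning
    ps = 0# ∷ 1# ∷ - 1# ∷ []
    distinct-ps : AllPairs (λ x y → ¬ x ≈ y) ps
    distinct-ps = (0≉1 ∷ 0≉-x 1≉0 ∷ []) ∷ (1≉-1 ∷ []) ∷ [] ∷ []
    listed⇒¬adm : ∀ {x} → x ∈ₛ ps → ¬ Admissible x
    listed⇒¬adm (here x≈0) (x≉0 , _) = x≉0 x≈0
    listed⇒¬adm (there (here x≈1)) (_ , x²≉1 , _) = x²≉1 (trans (*-cong x≈1 x≈1) 1²≈1)
    listed⇒¬adm (there (there (here x≈-1))) (_ , x²≉1 , _) = x²≉1 (trans (*-cong x≈-1 x≈-1) [-1]²≈1)
    ¬adm⇒listed : ∀ {x} → ¬ Admissible x → x ∈ₛ ps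
    ¬adm⇒listed {x} ¬adm with non-admissible ¬adm
    ... | inj₁ x≈0 = here x≈0
    ... | inj₂ (inj₁ x²≈1) =
      [ (λ x≈1 → there (here x≈1)) , (λ x≈-1 → there (there (here x≈-1))) ]′ (x²≈1⇒x≈±1 x²≈1)
    ... | inj₂ (inj₂ x²≈-1) =
      contradiction (Any.map (λ x≈y → trans (*-cong (sym x≈y) (sym x≈y)) x²≈-1) (complete x)) none

  i : Carrier
  i = proj₁ √-1

  i²≈-1 : i * i ≈ - 1#
  i²≈-1 = proj₂ √-1

  private
    i≉0 : ¬ i ≈ 0#
    i≉0 i≈0 = 0≉-x 1≉0 (trans (sym (zeroˡ i)) (trans (*-congʳ (sym i≈0)) i²≈-1))

    [-i]²≈-1 : - i * - i ≈ - 1#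
    [-i]²≈-1 = trans (solve 1 (λ i → :- i :* :- i := i :* i) refl i) i²≈-1

    count-admissible+5≡q : count admissible? ℕ.+ 5 ≡ 4 ℕ.* m ℕ.+ 1
    count-admissible+5≡q = count-admissible-complement ps distinct-ps listed⇒¬adm ¬adm⇒listed
      where
      ps = 0# ∷ 1# ∷ - 1# ∷ i ∷ - i ∷ []
      0≉ : ∀ {x u} → x * x ≈ u → ¬ 0# ≈ u → ¬ 0# ≈ x
      0≉ x²≈u 0≉u = square-separates 0²≈0 x²≈u 0≉u
      1≉ : ∀ {x} → x * x ≈ - 1# → ¬ 1# ≈ x
      1≉ x²≈-1 = square-separates 1²≈1 x²≈-1 1≉-1
      -1≉ : ∀ {x} → x * x ≈ - 1# → ¬ - 1# ≈ x
      -1≉ x²≈-1 = square-separates [-1]²≈1 x²≈-1 1≉-1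
      distinct-ps : AllPairs (λ x y → ¬ x ≈ y) ps
      distinct-ps = (0≉1 ∷ 0≉-x 1≉0 ∷ 0≉ i²≈-1 (0≉-x 1≉0) ∷ 0≉ [-i]²≈-1 (0≉-x 1≉0) ∷ [])
                  ∷ (1≉-1 ∷ 1≉ i²≈-1 ∷ 1≉ [-i]²≈-1 ∷ [])
                  ∷ (-1≉ i²≈-1 ∷ -1≉ [-i]²≈-1 ∷ [])
                  ∷ (x≉0⇒x≉-x i≉0 ∷ [])
                  ∷ [] ∷ []
      listed⇒¬adm : ∀ {x} → x ∈ₛ ps → ¬ Admissible x
      listed⇒¬adm (here x≈0) (x≉0 , _) = x≉0 x≈0
      listed⇒¬adm (there (here x≈1)) (_ , x²≉1 , _) = x²≉1 (trans (*-cong x≈1 x≈1) 1²≈1)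
      listed⇒¬adm (there (there (here x≈-1))) (_ , x²≉1 , _) = x²≉1 (trans (*-cong x≈-1 x≈-1) [-1]²≈1)
      listed⇒¬adm (there (there (there (here x≈i)))) (_ , _ , x²≉-1) = x²≉-1 (trans (*-cong x≈i x≈i) i²≈-1)
      listed⇒¬adm (there (there (there (there (here x≈-i))))) (_ , _ , x²≉-1) =
        x²≉-1 (trans (*-cong x≈-i x≈-i) [-i]²≈-1)
      ¬adm⇒listed : ∀ {x} → ¬ Admissible x → x ∈ₛ ps
      ¬adm⇒listed ¬adm with non-admissible ¬adm
      ... | inj₁ x≈0 = here x≈0
      ... | inj₂ (inj₁ x²≈1) = [ (λ x≈1 → there (here x≈1)) , (λ x≈-1 → there (there (here x≈-1))) ]′
                                 (x²≈1⇒x≈±1 x²≈1)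
      ... | inj₂ (inj₂ x²≈-1) = [ (λ x≈i → there (there (there (here x≈i))))
                                , (λ x≈-i → there (there (there (there (here x≈-i))))) ]′
                                  (square-injective (trans x²≈-1 (sym i²≈-1)))

  isSquare? : Decidable IsSquare
  isSquare? x with any? (λ y → (y * y) ≟ x) xs
  ... | yes found = yes (Any.satisfied found)
  ... | no none = no (λ (y , y²≈x) → none (Any.map (λ y≈z → trans (*-cong (sym y≈z) (sym y≈z)) y²≈x) (complete y)))

  consecutiveSquares? : Decidable ConsecutiveSquares
  consecutiveSquares? s = (¬? (s ≟ 0#) ×-dec isSquare? s) ×-dec (¬? ((s - 1#) ≟ 0#) ×-dec isSquare? (s - 1#))

  -- If a² = s and b² = s - 1 then t = a + b has t⁻¹ = a - b, hence joukowski t = a.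
  image≐consecutiveSquares : Image Admissible ≐ ConsecutiveSquares
  image≐consecutiveSquares = image⇒ , ⇒image
    where
    image⇒ : ∀ {s} → Image Admissible s → ConsecutiveSquares s
    image⇒ {s} im with Any.satisfied im
    ... | t , (t≉0 , t²≉1 , t²≉-1) , J²t≈s =
        ((λ s≈0 → t²≉-1 (joukowski≈0⇒t²≈-1 t≉0 (square≈0⇒≈0 (trans J²t≈s s≈0)))) , joukowski t , J²t≈s) ,
        ((λ s-1≈0 → t²≉1 (joukowski⁻≈0⇒t²≈1 t≉0 (square≈0⇒≈0 (trans K²≈s-1 s-1≈0)))) ,
         joukowski⁻ t , K²≈s-1)
      where
      K²≈s-1 : joukowski⁻ t * joukowski⁻ t ≈ s - 1#
      K²≈s-1 = trans (sym (joukowski²-joukowski⁻²≈1 t≉0)) (+-congʳ J²t≈s)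
    ⇒image : ∀ {s} → ConsecutiveSquares s → Image Admissible s
    ⇒image {s} ((s≉0 , a , a²≈s) , (s-1≉0 , b , b²≈s-1)) =
        Any.map (λ t≈t′ → admissible-cong t≈t′ adm , trans (joukowski²-cong (sym t≈t′)) J²t≈s) (complete t)
      where
      t = a + b
      a²-b²≈1 : a * a - b * b ≈ 1#
      a²-b²≈1 = combination₂ 1# (- 1#) (solve 3 (λ a b s →
        a :* a :- b :* b :- con (+ 1) := con (+ 1) :* (a :* a :- s) :+ :- con (+ 1) :* (b :* b :- (s :- con (+ 1))))
        refl a b s) a²≈s b²≈s-1
      t[a-b]≈1 : t * (a - b) ≈ 1#
      t[a-b]≈1 = trans (solve 2 (λ a b → (a :+ b) :* (a :- b) := a :* a :- b :* b) refl a b) a²-b²≈1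
      t≉0 : ¬ t ≈ 0#
      t≉0 = *≈1⇒≉0 t[a-b]≈1
      a≉0 : ¬ a ≈ 0#
      a≉0 a≈0 = s≉0 (trans (sym a²≈s) (trans (*-congʳ a≈0) (zeroˡ a)))
      b≉0 : ¬ b ≈ 0#
      b≉0 b≈0 = s-1≉0 (trans (sym b²≈s-1) (trans (*-congʳ b≈0) (zeroˡ b)))
      adm : Admissible t
      adm = t≉0 , t²≉1 , t²≉-1
        where
        t²≉1 : ¬ t * t ≈ 1#
        t²≉1 t²≈1 = b≉0 (x≈-x⇒x≈0 (combination₁ (- 1#) (solve 2 (λ a b →
          b :- :- b := :- con (+ 1) :* ((a :- b) :- (a :+ b))) refl a b)
          (*-cancelˡ t≉0 (trans t[a-b]≈1 (sym t²≈1)))))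
        t²≉-1 : ¬ t * t ≈ - 1#
        t²≉-1 t²≈-1 = a≉0 (x≈-x⇒x≈0 (combination₁ 1# (solve 2 (λ a b →
          a :- :- a := con (+ 1) :* ((a :+ b) :- :- (a :- b))) refl a b)
          (*-cancelˡ t≉0 (trans t²≈-1 (trans (-‿cong (sym t[a-b]≈1))
            (solve 2 (λ a b → :- ((a :+ b) :* (a :- b)) := (a :+ b) :* :- (a :- b)) refl a b))))))
      J²t≈s : joukowski² t ≈ s
      J²t≈s = trans (*-cong (joukowski-of-sum a²-b²≈1) (joukowski-of-sum a²-b²≈1)) a²≈s

  count-consecutiveSquares : count consecutiveSquares? ≡ (length xs ∸ 5) / 4
  count-consecutiveSquares = ≡.sym (q≡4m+5⇒[q∸5]/4≡m (length xs) (count consecutiveSquares?) (begin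
    length xs                                  ≡⟨ |R|≡4m+1 ⟩
    4 ℕ.* m ℕ.+ 1                              ≡⟨ count-admissible+5≡q ⟨
    count admissible? ℕ.+ 5                    ≡⟨ ≡.cong (ℕ._+ 5) count-admissible ⟩
    4 ℕ.* count (image? admissible?) ℕ.+ 5     ≡⟨ ≡.cong (λ n → 4 ℕ.* n ℕ.+ 5)
                                                   (count-cong (image? admissible?) consecutiveSquares?
                                                               image≐consecutiveSquares) ⟩
    4 ℕ.* count consecutiveSquares? ℕ.+ 5      ∎))
    where open ≡.≡-Reasoning


module PSL (R : CommutativeRing 0ℓ 0ℓ) where
  open import Data.Integer.Base using (+_)
  open import Data.Product using (_,_)
  open import Data.Sum using (inj₁; inj₂)

  open CommutativeRing R
  open Mat R
  open IntegerSolver R using (solve; _:=_; _:+_; _:*_; _:-_; :-_; con; combination₁)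

  ≈M-sym : ∀ {X Y} → X ≈M Y → Y ≈M X
  ≈M-sym (e₁ , e₂ , e₃ , e₄) = sym e₁ , sym e₂ , sym e₃ , sym e₄

  ≈M-trans : ∀ {X Y Z} → X ≈M Y → Y ≈M Z → X ≈M Z
  ≈M-trans (e₁ , e₂ , e₃ , e₄) (f₁ , f₂ , f₃ , f₄) =
    trans e₁ f₁ , trans e₂ f₂ , trans e₃ f₃ , trans e₄ f₄

  negM-cong : ∀ {X Y} → X ≈M Y → negM X ≈M negM Y
  negM-cong (e₁ , e₂ , e₃ , e₄) = -‿cong e₁ , -‿cong e₂ , -‿cong e₃ , -‿cong e₄

  negM-involutive : ∀ X → negM (negM X) ≈M X
  negM-involutive X = -‿involutive (a X) , -‿involutive (b X) , -‿involutive (c X) , -‿involutive (d X)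
    where
    -‿involutive : ∀ x → - - x ≈ x
    -‿involutive = solve 1 (λ x → :- :- x := x) refl

  ∼-sym : ∀ {X Y} → X ∼ Y → Y ∼ X
  ∼-sym (inj₁ X≈Y) = inj₁ (≈M-sym X≈Y)
  ∼-sym {X} (inj₂ X≈-Y) = inj₂ (≈M-trans (≈M-sym (negM-involutive _)) (negM-cong (≈M-sym X≈-Y)))

  ∼-trans : ∀ {X Y Z} → X ∼ Y → Y ∼ Z → X ∼ Z
  ∼-trans (inj₁ X≈Y) (inj₁ Y≈Z) = inj₁ (≈M-trans X≈Y Y≈Z)
  ∼-trans (inj₁ X≈Y) (inj₂ Y≈-Z) = inj₂ (≈M-trans X≈Y Y≈-Z)
  ∼-trans (inj₂ X≈-Y) (inj₁ Y≈Z) = inj₂ (≈M-trans X≈-Y (negM-cong Y≈Z))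
  ∼-trans (inj₂ X≈-Y) (inj₂ Y≈-Z) = inj₁ (≈M-trans X≈-Y (≈M-trans (negM-cong Y≈-Z) (negM-involutive _)))

  ·-congʳ : ∀ {X Y} Z → X ≈M Y → (X · Z) ≈M (Y · Z)
  ·-congʳ Z (e₁ , e₂ , e₃ , e₄) =
    +-cong (*-congʳ e₁) (*-congʳ e₂) , +-cong (*-congʳ e₁) (*-congʳ e₂) ,
    +-cong (*-congʳ e₃) (*-congʳ e₄) , +-cong (*-congʳ e₃) (*-congʳ e₄)

  negM-· : ∀ X Z → (negM X · Z) ≈M negM (X · Z)
  negM-· X Z = entry (a X) (a Z) (b X) (c Z) , entry (a X) (b Z) (b X) (d Z) ,
               entry (c X) (a Z) (d X) (c Z) , entry (c X) (b Z) (d X) (d Z)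
    where
    entry : ∀ p q r s → - p * q + - r * s ≈ - (p * q + r * s)
    entry = solve 4 (λ p q r s → :- p :* q :+ :- r :* s := :- (p :* q :+ r :* s)) refl

  ∼-·ʳ : ∀ {X Y} Z → X ∼ Y → (X · Z) ∼ (Y · Z)
  ∼-·ʳ Z (inj₁ X≈Y) = inj₁ (·-congʳ Z X≈Y)
  ∼-·ʳ {Y = Y} Z (inj₂ X≈-Y) = inj₂ (≈M-trans (·-congʳ Z X≈-Y) (negM-· Y Z))

  det-cong : ∀ {X Y} → X ≈M Y → det X ≈ det Y
  det-cong (e₁ , e₂ , e₃ , e₄) = +-cong (*-cong e₁ e₄) (-‿cong (*-cong e₂ e₃))

  det-negM : ∀ X → det (negM X) ≈ det X
  det-negM X = solve 4 (λ p q r s → :- p :* :- s :- :- q :* :- r := p :* s :- q :* r) refl (a X) (b X) (c X) (d X)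

  det-· : ∀ X Y → det (X · Y) ≈ det X * det Y
  det-· X Y = solve 8 (λ p q r s p′ q′ r′ s′ →
      (p :* p′ :+ q :* r′) :* (r :* q′ :+ s :* s′) :- (p :* q′ :+ q :* s′) :* (r :* p′ :+ s :* r′)
      := (p :* s :- q :* r) :* (p′ :* s′ :- q′ :* r′)) refl (a X) (b X) (c X) (d X) (a Y) (b Y) (c Y) (d Y)

  InSL-· : ∀ {X Y} → InSL X → InSL Y → InSL (X · Y)
  InSL-· {X} {Y} detX≈1 detY≈1 = trans (det-· X Y) (trans (*-cong detX≈1 detY≈1) (*-identityˡ 1#))

  InSL-∼ : ∀ {X Y} → X ∼ Y → InSL Y → InSL X
  InSL-∼ (inj₁ X≈Y) detY≈1 = trans (det-cong X≈Y) detY≈1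
  InSL-∼ {Y = Y} (inj₂ X≈-Y) detY≈1 = trans (det-cong X≈-Y) (trans (det-negM Y) detY≈1)

  InD-∼ : ∀ {Δ X Y} → X ∼ Y → InD Δ Y → InD Δ X
  InD-∼ X∼Y (Y∈SL , H , H∈SL , Y∼HRH⁻¹) = InSL-∼ X∼Y Y∈SL , H , H∈SL , ∼-trans X∼Y Y∼HRH⁻¹

  -- I + Δ (u, v)ᵀ (-v, u): the conjugate of R_Δ by any H ∈ SL₂ with first column (u, v).
  U : Carrier → Carrier → Carrier → M2
  U Δ u v = mat (1# - Δ * u * v) (Δ * u * u) (- (Δ * v * v)) (1# + Δ * u * v)

  conjugate-RΔ : ∀ {Δ H} → InSL H → ((H · RΔ Δ) · invM H) ≈M U Δ (a H) (c H)
  conjugate-RΔ {Δ} {mat h₁ h₂ h₃ h₄} detH≈1 =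
    combination₁ 1# (solve 5 (λ h₁ h₂ h₃ h₄ Δ →
      (h₁ :* con (+ 1) :+ h₂ :* con (+ 0)) :* h₄ :+ (h₁ :* Δ :+ h₂ :* con (+ 1)) :* :- h₃
        :- (con (+ 1) :- Δ :* h₁ :* h₃)
      := con (+ 1) :* ((h₁ :* h₄ :- h₂ :* h₃) :- con (+ 1))) refl h₁ h₂ h₃ h₄ Δ) detH≈1 ,
    solve 5 (λ h₁ h₂ h₃ h₄ Δ →
      (h₁ :* con (+ 1) :+ h₂ :* con (+ 0)) :* :- h₂ :+ (h₁ :* Δ :+ h₂ :* con (+ 1)) :* h₁
      := Δ :* h₁ :* h₁) refl h₁ h₂ h₃ h₄ Δ ,
    solve 5 (λ h₁ h₂ h₃ h₄ Δ →
      (h₃ :* con (+ 1) :+ h₄ :* con (+ 0)) :* h₄ :+ (h₃ :* Δ :+ h₄ :* con (+ 1)) :* :- h₃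
      := :- (Δ :* h₃ :* h₃)) refl h₁ h₂ h₃ h₄ Δ ,
    combination₁ 1# (solve 5 (λ h₁ h₂ h₃ h₄ Δ →
      (h₃ :* con (+ 1) :+ h₄ :* con (+ 0)) :* :- h₂ :+ (h₃ :* Δ :+ h₄ :* con (+ 1)) :* h₁
        :- (con (+ 1) :+ Δ :* h₁ :* h₃)
      := con (+ 1) :* ((h₁ :* h₄ :- h₂ :* h₃) :- con (+ 1))) refl h₁ h₂ h₃ h₄ Δ) detH≈1


module Neighbourhood (R : CommutativeRing 0ℓ 0ℓ) (_≟_ : B.Decidable (CommutativeRing._≈_ R))
  (isField : Mat.IsField R)
  (2≉0 : ¬ CommutativeRing._≈_ R (DiscreteField.2# R _≟_ isField) (CommutativeRing.0# R))
  {i : CommutativeRing.Carrier R}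
  (i²≈-1 : CommutativeRing._≈_ R (CommutativeRing._*_ R i i) (CommutativeRing.-_ R (CommutativeRing.1# R)))
  {Δ Δi : CommutativeRing.Carrier R}
  (ΔΔi≈1 : CommutativeRing._≈_ R (CommutativeRing._*_ R Δ Δi) (CommutativeRing.1# R)) where
  open import Data.Integer.Base using (+_)
  open import Data.Product using (∃; ∃₂; _×_; _,_; proj₁)
  open import Data.Sum using (_⊎_; inj₁; inj₂)
  open import Function.Bundles using (_⇔_; mk⇔)
  open import Relation.Nullary.Negation using (contradiction)

  open CommutativeRing R
  open Mat R
  open DiscreteField R _≟_ isField
  open CharacteristicNot2 2≉0
  open PSL R

  Δ≉0 : ¬ Δ ≈ 0#
  Δ≉0 = *≈1⇒≉0 ΔΔi≈1

  Δi≉0 : ¬ Δi ≈ 0#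
  Δi≉0 = *≈1⇒≉0 (trans (*-comm Δi Δ) ΔΔi≈1)

  4≉0 : ¬ 4# ≈ 0#
  4≉0 4≈0 = *-nonzero 2≉0 2≉0 (trans (solve 0 (con (+ 2) :* con (+ 2) := con (+ 4)) refl) 4≈0)

  R⁻¹ : M2
  R⁻¹ = invM (RΔ Δ)

  T : Carrier → M2
  T s = mat 1# (s * Δ) 0# 1#

  M : Carrier → M2
  M β = mat (1# + 4# * β * Δi) (- (4# * β * β * Δi)) (4# * Δi) (1# - 4# * β * Δi)

  InD⇒∼U : ∀ {X} → InD Δ X → ∃₂ λ u v → (v ≈ 0# → ¬ u ≈ 0#) × X ∼ U Δ u v
  InD⇒∼U (_ , mat h₁ h₂ h₃ h₄ , detH≈1 , X∼HRH⁻¹) =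
    h₁ , h₃ , first-column≉0 , ∼-trans X∼HRH⁻¹ (inj₁ (conjugate-RΔ detH≈1))
    where
    first-column≉0 : h₃ ≈ 0# → ¬ h₁ ≈ 0#
    first-column≉0 h₃≈0 h₁≈0 = 0≉1 (sym (combination₃ (- 1#) h₄ (- h₂) (solve 4 (λ h₁ h₂ h₃ h₄ →
      con (+ 1) :- con (+ 0) := :- con (+ 1) :* ((h₁ :* h₄ :- h₂ :* h₃) :- con (+ 1))
                                :+ h₄ :* (h₁ :- con (+ 0)) :+ :- h₂ :* (h₃ :- con (+ 0))) refl h₁ h₂ h₃ h₄)
      detH≈1 h₁≈0 h₃≈0))

  ∼U⇒InD : ∀ {X u v} → InSL X → ¬ u ≈ 0# ⊎ ¬ v ≈ 0# → X ∼ U Δ u v → InD Δ X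
  ∼U⇒InD {X} {u} {v} X∈SL (inj₁ u≉0) X∼U =
    X∈SL , mat u 0# v (u ⁻¹) , detH≈1 , ∼-trans X∼U (inj₁ (≈M-sym (conjugate-RΔ detH≈1)))
    where
    detH≈1 : InSL (mat u 0# v (u ⁻¹))
    detH≈1 = trans (solve 3 (λ u v u⁻¹ → u :* u⁻¹ :- con (+ 0) :* v := u :* u⁻¹) refl u v (u ⁻¹)) (⁻¹-inverseʳ u≉0)
  ∼U⇒InD {X} {u} {v} X∈SL (inj₂ v≉0) X∼U =
    X∈SL , mat u (- v ⁻¹) v 0# , detH≈1 , ∼-trans X∼U (inj₁ (≈M-sym (conjugate-RΔ detH≈1)))
    where
    detH≈1 : InSL (mat u (- v ⁻¹) v 0#)
    detH≈1 = trans (solve 3 (λ u v v⁻¹ → u :* con (+ 0) :- :- v⁻¹ :* v := v⁻¹ :* v) refl u v (v ⁻¹))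
                   (⁻¹-inverseˡ v≉0)

  W : Carrier → Carrier → M2
  W u v = mat (1# - Δ * u * v) (Δ * u * u - Δ * (1# - Δ * u * v)) (- (Δ * v * v)) (1# + Δ * u * v + Δ * Δ * v * v)

  U·R⁻¹ : ∀ u v → (U Δ u v · R⁻¹) ≈M W u v
  U·R⁻¹ u v =
    solve 3 (λ Δ u v → (con (+ 1) :- Δ :* u :* v) :* con (+ 1) :+ Δ :* u :* u :* :- con (+ 0)
                       := con (+ 1) :- Δ :* u :* v) refl Δ u v ,
    solve 3 (λ Δ u v → (con (+ 1) :- Δ :* u :* v) :* :- Δ :+ Δ :* u :* u :* con (+ 1)
                       := Δ :* u :* u :- Δ :* (con (+ 1) :- Δ :* u :* v)) refl Δ u v ,
    solve 3 (λ Δ u v → :- (Δ :* v :* v) :* con (+ 1) :+ (con (+ 1) :+ Δ :* u :* v) :* :- con (+ 0)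
                       := :- (Δ :* v :* v)) refl Δ u v ,
    solve 3 (λ Δ u v → :- (Δ :* v :* v) :* :- Δ :+ (con (+ 1) :+ Δ :* u :* v) :* con (+ 1)
                       := con (+ 1) :+ Δ :* u :* v :+ Δ :* Δ :* v :* v) refl Δ u v

  private
    Δx≈0⇒x≈0 : ∀ {x} → Δ * x ≈ 0# → x ≈ 0#
    Δx≈0⇒x≈0 Δx≈0 with zero-product Δx≈0
    ... | inj₁ Δ≈0 = contradiction Δ≈0 Δ≉0
    ... | inj₂ x≈0 = x≈0

    Δx²≈0⇒x≈0 : ∀ {x} → Δ * x * x ≈ 0# → x ≈ 0#
    Δx²≈0⇒x≈0 Δx²≈0 with zero-product Δx²≈0
    ... | inj₁ Δx≈0 = Δx≈0⇒x≈0 Δx≈0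
    ... | inj₂ x≈0 = x≈0


  plus-case : ∀ {u v u′ v′} → (v ≈ 0# → ¬ u ≈ 0#) → (v′ ≈ 0# → ¬ u′ ≈ 0#) →
              W u v ≈M U Δ u′ v′ → C1 Δ (U Δ u v)
  plus-case {u} {v} {u′} {v′} nondegenerate nondegenerate′ (e₁ , e₂ , e₃ , e₄) =
    u , nondegenerate v≈0 , u≉1 , u≉-1 , (u′ , u′²≈u²-1) , inj₁ U≈T
    where
    -- the traces give 2 + Δ² v² ≈ 2
    v≈0 : v ≈ 0#
    v≈0 = Δx≈0⇒x≈0 (square≈0⇒≈0 (combination₁ 1# (solve 5 (λ Δ u v u′ v′ →
      (Δ :* v) :* (Δ :* v) :- con (+ 0)
      := con (+ 1) :* ((con (+ 1) :- Δ :* u :* v :+ (con (+ 1) :+ Δ :* u :* v :+ Δ :* Δ :* v :* v))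
                       :- (con (+ 1) :- Δ :* u′ :* v′ :+ (con (+ 1) :+ Δ :* u′ :* v′)))) refl Δ u v u′ v′)
      (+-cong e₁ e₄)))
    v′≈0 : v′ ≈ 0#
    v′≈0 = Δx²≈0⇒x≈0 (combination₂ 1# (Δ * v) (solve 3 (λ Δ v v′ →
      Δ :* v′ :* v′ :- con (+ 0) := con (+ 1) :* (:- (Δ :* v :* v) :- :- (Δ :* v′ :* v′)) :+ (Δ :* v) :* (v :- con (+ 0)))
      refl Δ v v′) e₃ v≈0)
    u′²≈u²-1 : u′ * u′ ≈ u * u - 1#
    u′²≈u²-1 = *-cancelˡ Δ≉0 (combination₂ (- 1#) (Δ * Δ * u) (solve 4 (λ Δ u v u′ →
      Δ :* (u′ :* u′) :- Δ :* (u :* u :- con (+ 1))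
      := :- con (+ 1) :* ((Δ :* u :* u :- Δ :* (con (+ 1) :- Δ :* u :* v)) :- Δ :* u′ :* u′)
         :+ (Δ :* Δ :* u) :* (v :- con (+ 0))) refl Δ u v u′) e₂ v≈0)
    u²≉1 : ¬ u * u ≈ 1#
    u²≉1 u²≈1 = nondegenerate′ v′≈0 (square≈0⇒≈0 (trans u′²≈u²-1 (x≈y⇒x-y≈0 u²≈1)))
    u≉1 : ¬ u ≈ 1#
    u≉1 u≈1 = u²≉1 (trans (*-cong u≈1 u≈1) (*-identityˡ 1#))
    u≉-1 : ¬ u ≈ - 1#
    u≉-1 u≈-1 = u²≉1 (trans (*-cong u≈-1 u≈-1) [-1]²≈1)
    U≈T : U Δ u v ≈M mat 1# (u * u * Δ) 0# 1#
    U≈T = combination₁ (- (Δ * u)) (solve 3 (λ Δ u v →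
            con (+ 1) :- Δ :* u :* v :- con (+ 1) := :- (Δ :* u) :* (v :- con (+ 0))) refl Δ u v) v≈0 ,
          solve 2 (λ Δ u → Δ :* u :* u := u :* u :* Δ) refl Δ u ,
          combination₁ (- (Δ * v)) (solve 2 (λ Δ v →
            :- (Δ :* v :* v) :- con (+ 0) := :- (Δ :* v) :* (v :- con (+ 0))) refl Δ v) v≈0 ,
          combination₁ (Δ * u) (solve 3 (λ Δ u v →
            con (+ 1) :+ Δ :* u :* v :- con (+ 1) := (Δ :* u) :* (v :- con (+ 0))) refl Δ u v) v≈0

  ¼ : Carrier
  ¼ = 4# ⁻¹

  4¼≈1 : 4# * ¼ ≈ 1#
  4¼≈1 = ⁻¹-inverseʳ 4≉0

  minus-case : ∀ {u v u′ v′} → W u v ≈M negM (U Δ u′ v′) → C2 Δ Δi (U Δ u v)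
  minus-case {u} {v} {u′} {v′} (e₁ , _ , _ , e₄) = β , inj₁ (a≈ , b≈ , c≈ , d≈)
    where
    β : Carrier
    β = - (Δ * Δ * u * v) * ¼
    -- the traces give 2 + Δ² v² ≈ -2
    Δ²v²≈-4 : Δ * Δ * v * v ≈ - 4#
    Δ²v²≈-4 = combination₁ 1# (solve 5 (λ Δ u v u′ v′ →
      Δ :* Δ :* v :* v :- :- con (+ 4)
      := con (+ 1) :* ((con (+ 1) :- Δ :* u :* v :+ (con (+ 1) :+ Δ :* u :* v :+ Δ :* Δ :* v :* v))
                       :- (:- (con (+ 1) :- Δ :* u′ :* v′) :+ :- (con (+ 1) :+ Δ :* u′ :* v′)))) refl Δ u v u′ v′)
      (+-cong e₁ e₄)
    a≈ : 1# - Δ * u * v ≈ 1# + 4# * β * Δi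
    a≈ = combination₂ (Δ * u * v * (Δ * Δi)) (Δ * u * v) (solve 5 (λ Δ u v ¼ Δi →
      con (+ 1) :- Δ :* u :* v :- (con (+ 1) :+ con (+ 4) :* (:- (Δ :* Δ :* u :* v) :* ¼) :* Δi)
      := (Δ :* u :* v :* (Δ :* Δi)) :* (con (+ 4) :* ¼ :- con (+ 1)) :+ (Δ :* u :* v) :* (Δ :* Δi :- con (+ 1)))
      refl Δ u v ¼ Δi) 4¼≈1 ΔΔi≈1
    b≈ : Δ * u * u ≈ - (4# * β * β * Δi)
    b≈ = combination₃ (4# * Δ * Δ * u * u * ¼ * ¼ * Δi) (- (Δ * u * u * ((4# * ¼) * (4# * ¼))))
                      (- (Δ * u * u * (4# * ¼ + 1#))) (solve 5 (λ Δ u v ¼ Δi →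
      Δ :* u :* u :- :- (con (+ 4) :* (:- (Δ :* Δ :* u :* v) :* ¼) :* (:- (Δ :* Δ :* u :* v) :* ¼) :* Δi)
      := (con (+ 4) :* Δ :* Δ :* u :* u :* ¼ :* ¼ :* Δi) :* (Δ :* Δ :* v :* v :- :- con (+ 4))
         :+ :- (Δ :* u :* u :* ((con (+ 4) :* ¼) :* (con (+ 4) :* ¼))) :* (Δ :* Δi :- con (+ 1))
         :+ :- (Δ :* u :* u :* (con (+ 4) :* ¼ :+ con (+ 1))) :* (con (+ 4) :* ¼ :- con (+ 1)))
      refl Δ u v ¼ Δi) Δ²v²≈-4 ΔΔi≈1 4¼≈1
    c≈ : - (Δ * v * v) ≈ 4# * Δi
    c≈ = combination₂ (- Δi) (Δ * v * v) (solve 3 (λ Δ v Δi →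
      :- (Δ :* v :* v) :- con (+ 4) :* Δi
      := :- Δi :* (Δ :* Δ :* v :* v :- :- con (+ 4)) :+ (Δ :* v :* v) :* (Δ :* Δi :- con (+ 1))) refl Δ v Δi)
      Δ²v²≈-4 ΔΔi≈1
    d≈ : 1# + Δ * u * v ≈ 1# - 4# * β * Δi
    d≈ = combination₂ (- (Δ * u * v * (Δ * Δi))) (- (Δ * u * v)) (solve 5 (λ Δ u v ¼ Δi →
      con (+ 1) :+ Δ :* u :* v :- (con (+ 1) :- con (+ 4) :* (:- (Δ :* Δ :* u :* v) :* ¼) :* Δi)
      := :- (Δ :* u :* v :* (Δ :* Δi)) :* (con (+ 4) :* ¼ :- con (+ 1)) :+ :- (Δ :* u :* v) :* (Δ :* Δi :- con (+ 1)))
      refl Δ u v ¼ Δi) 4¼≈1 ΔΔi≈1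

  Nbr-∼ : ∀ {X Y} → X ∼ Y → Nbr Δ Y → Nbr Δ X
  Nbr-∼ X∼Y (Y∈D , Y≁RΔ , YR⁻¹∈D) =
    InD-∼ X∼Y Y∈D , (λ X∼RΔ → Y≁RΔ (∼-trans (∼-sym X∼Y) X∼RΔ)) , InD-∼ (∼-·ʳ R⁻¹ X∼Y) YR⁻¹∈D

  T-in-D : ∀ {s} → NonzeroSquare s → InD Δ (T s)
  T-in-D {s} (s≉0 , α , α²≈s) = ∼U⇒InD T∈SL (inj₁ α≉0) (inj₁ T≈U)
    where
    α≉0 : ¬ α ≈ 0#
    α≉0 α≈0 = s≉0 (trans (sym α²≈s) (trans (*-congʳ α≈0) (zeroˡ α)))
    T∈SL : InSL (T s)
    T∈SL = solve 2 (λ s Δ → con (+ 1) :* con (+ 1) :- (s :* Δ) :* con (+ 0) := con (+ 1)) refl s Δ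
    T≈U : T s ≈M U Δ α 0#
    T≈U = solve 2 (λ Δ α → con (+ 1) := con (+ 1) :- Δ :* α :* con (+ 0)) refl Δ α ,
          combination₁ (- Δ) (solve 3 (λ s Δ α → s :* Δ :- Δ :* α :* α := :- Δ :* (α :* α :- s)) refl s Δ α) α²≈s ,
          solve 1 (λ Δ → con (+ 0) := :- (Δ :* con (+ 0) :* con (+ 0))) refl Δ ,
          solve 2 (λ Δ α → con (+ 1) := con (+ 1) :+ Δ :* α :* con (+ 0)) refl Δ α

  T·R⁻¹ : ∀ s → (T s · R⁻¹) ≈M T (s - 1#)
  T·R⁻¹ s =
    solve 2 (λ s Δ → con (+ 1) :* con (+ 1) :+ (s :* Δ) :* :- con (+ 0) := con (+ 1)) refl s Δ ,
    solve 2 (λ s Δ → con (+ 1) :* :- Δ :+ (s :* Δ) :* con (+ 1) := (s :- con (+ 1)) :* Δ) refl s Δ ,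
    solve 1 (λ Δ → con (+ 0) :* con (+ 1) :+ con (+ 1) :* :- con (+ 0) := con (+ 0)) refl Δ ,
    solve 1 (λ Δ → con (+ 0) :* :- Δ :+ con (+ 1) :* con (+ 1) := con (+ 1)) refl Δ

  T-nbr : ∀ {s} → ConsecutiveSquares s → Nbr Δ (T s)
  T-nbr {s} (s∈□ , s-1∈□) = T-in-D s∈□ , T≁RΔ , InD-∼ (inj₁ (T·R⁻¹ s)) (T-in-D s-1∈□)
    where
    T≁RΔ : ¬ T s ∼ RΔ Δ
    T≁RΔ (inj₁ (_ , sΔ≈Δ , _ , _)) =
      proj₁ s-1∈□ (x≈y⇒x-y≈0 (*-cancelʳ Δ≉0 (trans sΔ≈Δ (sym (*-identityˡ Δ)))))
    T≁RΔ (inj₂ (1≈-1 , _)) = 1≉-1 1≈-1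

  M-nbr : ∀ β → Nbr Δ (M β)
  M-nbr β = ∼U⇒InD M∈SL (inj₂ v≉0) (inj₁ M≈U) , M≁RΔ ,
            ∼U⇒InD (InSL-· M∈SL R⁻¹∈SL) (inj₂ v′≉0) (inj₂ MR⁻¹≈-U′)
    where
    -- -Δ v² = 4 Δi is the lower left entry of M β; this is where √-1 is needed.
    v = 2# * i * Δi
    u = 2# * i * β * Δi
    v′ = 2# * Δi
    u′ = 1# + 2# * β * Δi
    v≉0 : ¬ v ≈ 0#
    v≉0 = *-nonzero (*-nonzero 2≉0 i≉0) Δi≉0
      where
      i≉0 : ¬ i ≈ 0#
      i≉0 i≈0 = -‿nonzero 1≉0 (trans (sym i²≈-1) (trans (*-congʳ i≈0) (zeroˡ i)))
    v′≉0 : ¬ v′ ≈ 0#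
    v′≉0 = *-nonzero 2≉0 Δi≉0
    M∈SL : InSL (M β)
    M∈SL = solve 2 (λ β Δi →
      (con (+ 1) :+ con (+ 4) :* β :* Δi) :* (con (+ 1) :- con (+ 4) :* β :* Δi)
      :- :- (con (+ 4) :* β :* β :* Δi) :* (con (+ 4) :* Δi) := con (+ 1)) refl β Δi
    R⁻¹∈SL : InSL R⁻¹
    R⁻¹∈SL = solve 1 (λ Δ → con (+ 1) :* con (+ 1) :- :- Δ :* :- con (+ 0) := con (+ 1)) refl Δ
    M≈U : M β ≈M U Δ u v
    M≈U =
      combination₂ (4# * β * Δi * (Δ * Δi)) (- (4# * β * Δi)) (solve 4 (λ Δ Δi i β →
        con (+ 1) :+ con (+ 4) :* β :* Δi :- (con (+ 1) :- Δ :* (con (+ 2) :* i :* β :* Δi) :* (con (+ 2) :* i :* Δi))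
        := (con (+ 4) :* β :* Δi :* (Δ :* Δi)) :* (i :* i :- :- con (+ 1)) :+ :- (con (+ 4) :* β :* Δi) :* (Δ :* Δi :- con (+ 1)))
        refl Δ Δi i β) i²≈-1 ΔΔi≈1 ,
      combination₂ (- (4# * β * β * Δi * (Δ * Δi))) (4# * β * β * Δi) (solve 4 (λ Δ Δi i β →
        :- (con (+ 4) :* β :* β :* Δi) :- Δ :* (con (+ 2) :* i :* β :* Δi) :* (con (+ 2) :* i :* β :* Δi)
        := :- (con (+ 4) :* β :* β :* Δi :* (Δ :* Δi)) :* (i :* i :- :- con (+ 1))
           :+ (con (+ 4) :* β :* β :* Δi) :* (Δ :* Δi :- con (+ 1)))
        refl Δ Δi i β) i²≈-1 ΔΔi≈1 ,
      combination₂ (4# * Δi * (Δ * Δi)) (- (4# * Δi)) (solve 3 (λ Δ Δi i →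
        con (+ 4) :* Δi :- :- (Δ :* (con (+ 2) :* i :* Δi) :* (con (+ 2) :* i :* Δi))
        := (con (+ 4) :* Δi :* (Δ :* Δi)) :* (i :* i :- :- con (+ 1)) :+ :- (con (+ 4) :* Δi) :* (Δ :* Δi :- con (+ 1)))
        refl Δ Δi i) i²≈-1 ΔΔi≈1 ,
      combination₂ (- (4# * β * Δi * (Δ * Δi))) (4# * β * Δi) (solve 4 (λ Δ Δi i β →
        con (+ 1) :- con (+ 4) :* β :* Δi :- (con (+ 1) :+ Δ :* (con (+ 2) :* i :* β :* Δi) :* (con (+ 2) :* i :* Δi))
        := :- (con (+ 4) :* β :* Δi :* (Δ :* Δi)) :* (i :* i :- :- con (+ 1)) :+ (con (+ 4) :* β :* Δi) :* (Δ :* Δi :- con (+ 1)))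
        refl Δ Δi i β) i²≈-1 ΔΔi≈1
    MR⁻¹≈-U′ : (M β · R⁻¹) ≈M negM (U Δ u′ v′)
    MR⁻¹≈-U′ =
      combination₁ (- (2# + 4# * β * Δi)) (solve 3 (λ Δ Δi β →
        (con (+ 1) :+ con (+ 4) :* β :* Δi) :* con (+ 1) :+ :- (con (+ 4) :* β :* β :* Δi) :* :- con (+ 0)
        :- :- (con (+ 1) :- Δ :* (con (+ 1) :+ con (+ 2) :* β :* Δi) :* (con (+ 2) :* Δi))
        := :- (con (+ 2) :+ con (+ 4) :* β :* Δi) :* (Δ :* Δi :- con (+ 1))) refl Δ Δi β) ΔΔi≈1 ,
      combination₁ (4# * β * β * Δi) (solve 3 (λ Δ Δi β →
        (con (+ 1) :+ con (+ 4) :* β :* Δi) :* :- Δ :+ :- (con (+ 4) :* β :* β :* Δi) :* con (+ 1)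
        :- :- (Δ :* (con (+ 1) :+ con (+ 2) :* β :* Δi) :* (con (+ 1) :+ con (+ 2) :* β :* Δi))
        := (con (+ 4) :* β :* β :* Δi) :* (Δ :* Δi :- con (+ 1))) refl Δ Δi β) ΔΔi≈1 ,
      combination₁ (- (4# * Δi)) (solve 3 (λ Δ Δi β →
        (con (+ 4) :* Δi) :* con (+ 1) :+ (con (+ 1) :- con (+ 4) :* β :* Δi) :* :- con (+ 0)
        :- :- :- (Δ :* (con (+ 2) :* Δi) :* (con (+ 2) :* Δi))
        := :- (con (+ 4) :* Δi) :* (Δ :* Δi :- con (+ 1))) refl Δ Δi β) ΔΔi≈1 ,
      combination₁ (- (2# - 4# * β * Δi)) (solve 3 (λ Δ Δi β →
        (con (+ 4) :* Δi) :* :- Δ :+ (con (+ 1) :- con (+ 4) :* β :* Δi) :* con (+ 1)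
        :- :- (con (+ 1) :+ Δ :* (con (+ 1) :+ con (+ 2) :* β :* Δi) :* (con (+ 2) :* Δi))
        := :- (con (+ 2) :- con (+ 4) :* β :* Δi) :* (Δ :* Δi :- con (+ 1))) refl Δ Δi β) ΔΔi≈1
    M≁RΔ : ¬ M β ∼ RΔ Δ
    M≁RΔ (inj₁ (_ , _ , 4Δi≈0 , _)) = *-nonzero 4≉0 Δi≉0 4Δi≈0
    M≁RΔ (inj₂ (_ , _ , 4Δi≈-0 , _)) = *-nonzero 4≉0 Δi≉0 (trans 4Δi≈-0 (solve 0 (:- con (+ 0) := con (+ 0)) refl))

  C1⇒consecutiveSquares : ∀ {X} → C1 Δ X → ∃ λ s → ConsecutiveSquares s × X ∼ T s
  C1⇒consecutiveSquares (α , α≉0 , α≉1 , α≉-1 , α²-1∈□ , X∼T) =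
    α * α , ((*-nonzero α≉0 α≉0 , α , refl) , (α²-1≉0 , α²-1∈□)) , X∼T
    where
    α²-1≉0 : ¬ α * α - 1# ≈ 0#
    α²-1≉0 α²-1≈0 with x²≈1⇒x≈±1 (x-y≈0⇒x≈y α²-1≈0)
    ... | inj₁ α≈1 = α≉1 α≈1
    ... | inj₂ α≈-1 = α≉-1 α≈-1

  C1-∼ : ∀ {X Y} → X ∼ Y → C1 Δ Y → C1 Δ X
  C1-∼ X∼Y (α , α≉0 , α≉1 , α≉-1 , α²-1∈□ , Y∼T) =
    α , α≉0 , α≉1 , α≉-1 , α²-1∈□ , ∼-trans X∼Y Y∼T

  C2-∼ : ∀ {X Y} → X ∼ Y → C2 Δ Δi Y → C2 Δ Δi X
  C2-∼ X∼Y (β , Y∼M) = β , ∼-trans X∼Y Y∼M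

  private
    conjugates⇒C1⊎C2 : ∀ {X u v u′ v′} → (v ≈ 0# → ¬ u ≈ 0#) → (v′ ≈ 0# → ¬ u′ ≈ 0#) →
                       X ∼ U Δ u v → (U Δ u v · R⁻¹) ∼ U Δ u′ v′ → C1 Δ X ⊎ C2 Δ Δi X
    conjugates⇒C1⊎C2 {u = u} {v} nd nd′ X∼U (inj₁ UR⁻¹≈U′) =
      inj₁ (C1-∼ X∼U (plus-case nd nd′ (≈M-trans (≈M-sym (U·R⁻¹ u v)) UR⁻¹≈U′)))
    conjugates⇒C1⊎C2 {u = u} {v} nd nd′ X∼U (inj₂ UR⁻¹≈-U′) =
      inj₂ (C2-∼ X∼U (minus-case (≈M-trans (≈M-sym (U·R⁻¹ u v)) UR⁻¹≈-U′)))

  Nbr⇒C1⊎C2 : ∀ {X} → Nbr Δ X → C1 Δ X ⊎ C2 Δ Δi X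
  Nbr⇒C1⊎C2 (X∈D , _ , XR⁻¹∈D) =
    let (_ , _ , nd , X∼U) = InD⇒∼U X∈D
        (_ , _ , nd′ , XR⁻¹∼U′) = InD⇒∼U XR⁻¹∈D
    in conjugates⇒C1⊎C2 nd nd′ X∼U (∼-trans (∼-sym (∼-·ʳ R⁻¹ X∼U)) XR⁻¹∼U′)

  C1⊎C2⇒Nbr : ∀ {X} → C1 Δ X ⊎ C2 Δ Δi X → Nbr Δ X
  C1⊎C2⇒Nbr (inj₁ c₁) = let (_ , s∈□□ , X∼T) = C1⇒consecutiveSquares c₁ in Nbr-∼ X∼T (T-nbr s∈□□)
  C1⊎C2⇒Nbr (inj₂ (β , X∼M)) = Nbr-∼ X∼M (M-nbr β)

  T-cong : ∀ {s s′} → s ≈ s′ → T s ≈M T s′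
  T-cong s≈s′ = refl , *-congʳ s≈s′ , refl , refl

  T-injective : ∀ {s s′} → T s ∼ T s′ → s ≈ s′
  T-injective (inj₁ (_ , sΔ≈s′Δ , _ , _)) = *-cancelʳ Δ≉0 sΔ≈s′Δ
  T-injective (inj₂ (1≈-1 , _)) = contradiction 1≈-1 1≉-1

  M-cong : ∀ {β β′} → β ≈ β′ → M β ≈M M β′
  M-cong β≈β′ = +-congˡ (*-congʳ (*-congˡ β≈β′)) , -‿cong (*-congʳ (*-cong (*-congˡ β≈β′) β≈β′)) ,
                refl , +-congˡ (-‿cong (*-congʳ (*-congˡ β≈β′)))

  M-injective : ∀ {β β′} → M β ∼ M β′ → β ≈ β′
  M-injective {β} {β′} (inj₁ (a≈a′ , _)) = *-cancelˡ (*-nonzero 4≉0 Δi≉0) (combination₁ 1# (solve 3 (λ β β′ Δi →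
    (con (+ 4) :* Δi) :* β :- (con (+ 4) :* Δi) :* β′
    := con (+ 1) :* ((con (+ 1) :+ con (+ 4) :* β :* Δi) :- (con (+ 1) :+ con (+ 4) :* β′ :* Δi))) refl β β′ Δi) a≈a′)
  M-injective (inj₂ (_ , _ , 4Δi≈-4Δi , _)) = contradiction (x≈-x⇒x≈0 4Δi≈-4Δi) (*-nonzero 4≉0 Δi≉0)

  T≁M : ∀ {s β} → ¬ T s ∼ M β
  T≁M (inj₁ (_ , _ , 0≈4Δi , _)) = *-nonzero 4≉0 Δi≉0 (sym 0≈4Δi)
  T≁M (inj₂ (_ , _ , 0≈-4Δi , _)) = -‿nonzero (*-nonzero 4≉0 Δi≉0) (sym 0≈-4Δi)

  Nbr⇔C1⊎C2 : ∀ {X} → Nbr Δ X ⇔ (C1 Δ X ⊎ C2 Δ Δi X)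
  Nbr⇔C1⊎C2 = mk⇔ Nbr⇒C1⊎C2 C1⊎C2⇒Nbr


module Representatives (R : CommutativeRing 0ℓ 0ℓ) (_≟_ : B.Decidable (CommutativeRing._≈_ R))
  (isField : Mat.IsField R) (xs : List (CommutativeRing.Carrier R))
  (complete : ∀ x → Any (CommutativeRing._≈_ R x) xs)
  (distinct : AllPairs (λ x y → ¬ CommutativeRing._≈_ R x y) xs)
  {m : ℕ} (|R|≡4m+1 : length xs ≡ 4 ℕ.* m ℕ.+ 1)
  {Δ Δi : CommutativeRing.Carrier R}
  (ΔΔi≈1 : CommutativeRing._≈_ R (CommutativeRing._*_ R Δ Δi) (CommutativeRing.1# R)) where
  open import Data.Nat.Base using (_∸_; _/_)
  open import Data.List.Base using (map; filter; _++_)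
  open import Data.List.Properties using (length-++; length-map)
  open import Data.List.Membership.Setoid.Properties using (∈-filter⁺)
  import Data.List.Relation.Unary.Any as Any
  import Data.List.Relation.Unary.Any.Properties as Anyₚ
  open import Data.List.Relation.Unary.All as All using (All)
  import Data.List.Relation.Unary.All.Properties as Allₚ
  import Data.List.Relation.Unary.AllPairs as AllPairs
  import Data.List.Relation.Unary.AllPairs.Properties as AllPairsₚ
  open import Data.Product using (_×_; _,_)
  open import Data.Sum using (_⊎_; inj₁; inj₂)
  open import Function.Base using (_∘_)
  import Relation.Binary.PropositionalEquality as ≡

  open CommutativeRing R
  open Mat R
  open DiscreteField R _≟_ isField
  open FiniteField R _≟_ isField xs complete distinct {m} |R|≡4m+1
  open PSL R
  open Neighbourhood R _≟_ isField 2≉0 i²≈-1 ΔΔi≈1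

  representatives : List M2
  representatives = map T (filter consecutiveSquares? xs) ++ map M xs

  representatives-nbr : All (λ X → InSL X × Nbr Δ X) representatives
  representatives-nbr = Allₚ.++⁺
    (Allₚ.map⁺ (All.map (λ s∈□□ → with-SL (T-nbr s∈□□)) (Allₚ.all-filter consecutiveSquares? xs)))
    (Allₚ.map⁺ (All.universal (λ β → with-SL (M-nbr β)) xs))
    where
    with-SL : ∀ {X} → Nbr Δ X → InSL X × Nbr Δ X
    with-SL nbr@((X∈SL , _) , _) = X∈SL , nbr

  representatives-distinct : AllPairs (λ X Y → ¬ X ∼ Y) representatives
  representatives-distinct = AllPairsₚ.++⁺
    (AllPairsₚ.map⁺ (AllPairsₚ.filter⁺ consecutiveSquares? (AllPairs.map (_∘ T-injective) distinct)))
    (AllPairsₚ.map⁺ (AllPairs.map (_∘ M-injective) distinct))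
    (Allₚ.map⁺ (All.universal (λ _ → Allₚ.map⁺ (All.universal (λ _ → T≁M) xs)) _))

  representatives-complete : ∀ X → Nbr Δ X → Any (X ∼_) representatives
  representatives-complete X nbr = listed (Nbr⇒C1⊎C2 nbr)
    where
    listed : C1 Δ X ⊎ C2 Δ Δi X → Any (X ∼_) representatives
    listed (inj₁ c₁) = let (s , s∈□□ , X∼Ts) = C1⇒consecutiveSquares c₁ in
      Anyₚ.++⁺ˡ (Anyₚ.map⁺ (Any.map (λ s≈s′ → ∼-trans X∼Ts (inj₁ (T-cong s≈s′)))
        (∈-filter⁺ setoid consecutiveSquares? ConsecutiveSquares-cong (complete s) s∈□□)))
    listed (inj₂ (β , X∼Mβ)) = Anyₚ.++⁺ʳ (map T (filter consecutiveSquares? xs))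
      (Anyₚ.map⁺ (Any.map (λ β≈β′ → ∼-trans X∼Mβ (inj₁ (M-cong β≈β′))) (complete β)))

  length-representatives : length representatives ≡ (length xs ∸ 5) / 4 ℕ.+ length xs
  length-representatives = ≡.trans (length-++ (map T (filter consecutiveSquares? xs)))
    (≡.cong₂ ℕ._+_ (≡.trans (length-map T (filter consecutiveSquares? xs)) count-consecutiveSquares)
                   (length-map M xs))


open import Level using (0ℓ)
open import Algebra.Bundles using (CommutativeRing)
open import Data.Nat using (ℕ; _≤_; _^_; _∸_; _/_; _+_; _*_)
open import Data.Nat.Primality using (Prime)
open import Data.Nat.Divisibility using (_∣_)
open import Data.List using (List; length)
open import Data.List.Relation.Unary.Any using (Any)
open import Data.List.Relation.Unary.All using (All)
open import Data.List.Relation.Unary.AllPairs using (AllPairs)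
open import Data.Product using (Σ; ∃; _×_)
open import Data.Sum using (_⊎_)
open import Function.Bundles using (_⇔_)
open import Relation.Nullary using (¬_)
open import Relation.Binary.PropositionalEquality using (_≡_)
open import Relation.Binary.Definitions using (Decidable)

open import Data.Nat.Base using (s≤s; z≤n)
open import Data.Nat.Properties using (≤-trans)
open import Data.Product using (_,_; proj₁; proj₂)
open import Relation.Binary.PropositionalEquality using (trans; subst)
open ModFour using (even-power-of-odd-prime)

lemma3p8 : (p k : ℕ) → Prime p → 5 ≤ p → 2 ∣ k →
    (R : CommutativeRing 0ℓ 0ℓ) →
    Decidable (CommutativeRing._≈_ R) →
    Mat.IsField R → Mat.HasCard R (p ^ k) →
    (Δ Δi : CommutativeRing.Carrier R) →
    ¬ Mat.IsSquare R Δ →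
    CommutativeRing._≈_ R (CommutativeRing._*_ R Δ Δi) (CommutativeRing.1# R) →
    (∀ X → Mat.InSL R X → (Mat.Nbr R Δ X ⇔ (Mat.C1 R Δ X ⊎ Mat.C2 R Δ Δi X)))
    × (Σ (List (Mat.M2 R)) λ L →
         All (λ X → Mat.InSL R X × Mat.Nbr R Δ X) L
         × AllPairs (λ X Y → ¬ Mat._∼_ R X Y) L
         × (∀ X → Mat.InSL R X → Mat.Nbr R Δ X → Any (Mat._∼_ R X) L)
         × length L ≡ ((p ^ k) ∸ 5) / 4 + p ^ k)
lemma3p8 p k p-prime 5≤p 2∣k R _≟_ isField (xs , |xs|≡q , complete , distinct) Δ Δi _ ΔΔi≈1 =
  (λ _ _ → Nbr⇔C1⊎C2) ,
  representatives , representatives-nbr , representatives-distinct , (λ X _ → representatives-complete X) ,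
  subst (λ q → length representatives ≡ (q ∸ 5) / 4 + q) |xs|≡q length-representatives
  where
  q≡1[4] = even-power-of-odd-prime p-prime (≤-trans (s≤s (s≤s (s≤s z≤n))) 5≤p) 2∣k
  |xs|≡4m+1 = trans |xs|≡q (proj₂ q≡1[4])
  open FiniteField R _≟_ isField xs complete distinct {proj₁ q≡1[4]} |xs|≡4m+1 using (2≉0; i²≈-1)
  open Neighbourhood R _≟_ isField 2≉0 i²≈-1 ΔΔi≈1 using (Nbr⇔C1⊎C2)
  open Representatives R _≟_ isField xs complete distinct {proj₁ q≡1[4]} |xs|≡4m+1 ΔΔi≈1
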